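{- Let $\mathbf{L}$ be one of the logics described in the context (determined by a set $N$ of non-logical rules). If a labelled sequent $\Gamma\Rightarrow\Delta$ is $\mathbf{Q\lambda.L}$-valid, then it is $\mathbf{G3Q\lambda.L}$-derivable.
   Context: Language $\mathcal{L}^\lambda$: fix a signature of $n$-ary predicate letters and an infinite set of variables $x,y,z,\dots$. Terms and formulas are defined simultaneously: terms $t::=x\mid \iota xA$ (definite descriptions, "the $x$ such that $A$"), formulas $A::=Px_1\dots x_n\mid x_1=x_2\mid\bot\mid A\wedge A\mid A\vee A\mid A\supset A\mid\forall xA\mid\exists xA\mid\Box A\mid\Diamond A\mid \lambda xA.t$. Thus descriptions occur in formulas only as the term of a $\lambda$-abstract. $\iota x$ binds $x$ in $A$; in $\lambda xA.t$ the occurrences of $x$ in $A$ are bound by $\lambda x$ (the displayed $t$ is not in its scope). $A[y/x]$ is the result of replacing the free occurrences of $x$ by $y$, with $y$ free for $x$. Atomic formulas are $Px_1\dots x_n$ and $x_1=x_2$. Semantics. A model is $\mathcal{M}=\langle\mathcal{W},\mathcal{R},\mathcal{D},\mathcal{V}\rangle$: $\mathcal{W}\neq\varnothing$ a set of worlds, $\mathcal{R}\subseteq\mathcal{W}\times\mathcal{W}$, $\mathcal{D}$ assigns to each $w$ a possibly empty set $D_w$ with $D_\mathcal{W}=\bigcup_w D_w$ nonempty and disjoint from $\mathcal{W}$, and $\mathcal{V}(P,w)\subseteq (D_\mathcal{W})^n$ for each $n$-ary $P$. An assignment $\sigma$ maps variables into $D_\mathcal{W}$; $\sigma^{x\triangleright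 o}$ is $\sigma$ with $x$ sent to $o$. Denotation: $\mathcal{V}^\sigma_w(x)=\sigma(x)$; $\mathcal{V}^\sigma_w(\iota xA)=o$ iff $o$ is the one and only member of $D_\mathcal{W}$ with $\sigma^{x\triangleright o}\models_w A$ (undefined otherwise). Satisfaction: $\sigma\models_w Px_1\dots x_n$ iff $\langle\sigma(x_1),\dots,\sigma(x_n)\rangle\in\mathcal{V}(P,w)$; $\sigma\models_w x=y$ iff $\sigma(x)=\sigma(y)$; $\bot$ never; Boolean connectives classical; $\sigma\models_w\forall xB$ iff $\sigma^{x\triangleright o}\models_w B$ for all $o\in D_w$; $\sigma\models_w\exists xB$ iff for some $o\in D_w$; $\sigma\models_w\Box B$ iff $\sigma\models_v B$ for all $v$ with $w\mathcal{R}v$; $\sigma\models_w\Diamond B$ iff for some such $v$; $\sigma\models_w\lambda xA.t$ iff $\mathcal{V}^\sigma_w(t)$ is defined and $\sigma^{x\triangleright\mathcal{V}^\sigma_w(t)}\models_w A$. Labelled sequents. Labels $w,v,u,\dots$ form a separate set. Expressions: labelled formulas $w:A$ ($A\in\mathcal{L}^\lambda$), domain atoms $x\in w$, relational atoms $w\mathscr{R}v$, denotation formulas $D(t,x,w)$ ($t$ a term, $x$ a variable). A sequent $\Gamma\Rightarrow\Delta$ has $\Gamma$ a multiset of labelled formulas, denotation formulas, domain atoms and relational atoms, and $\Delta$ a multiset of labelled formulas and denotation formulas. Substitutions $[y/x]$, $[w/v]$ extend componentwise. "Fresh" means not occurring in the conclusion of the rule. Calculus $\mathbf{G3Q\lambda.K}$.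 Initial sequents: $w:p,\Gamma\Rightarrow\Delta,w:p$ ($p$ atomic); $D(y,x,w),\Gamma\Rightarrow\Delta,D(y,x,w)$ ($y$ a variable); $w:\bot,\Gamma\Rightarrow\Delta$. Propositional rules (all at one label $w$): $L\wedge$: from $w:A,w:B,\Gamma\Rightarrow\Delta$ infer $w:A\wedge B,\Gamma\Rightarrow\Delta$; $R\wedge$: from $\Gamma\Rightarrow\Delta,w:A$ and $\Gamma\Rightarrow\Delta,w:B$ infer $\Gamma\Rightarrow\Delta,w:A\wedge B$; $L\vee$: from $w:A,\Gamma\Rightarrow\Delta$ and $w:B,\Gamma\Rightarrow\Delta$ infer $w:A\vee B,\Gamma\Rightarrow\Delta$; $R\vee$: from $\Gamma\Rightarrow\Delta,w:A,w:B$ infer $\Gamma\Rightarrow\Delta,w:A\vee B$; $L\supset$: from $\Gamma\Rightarrow\Delta,w:A$ and $w:B,\Gamma\Rightarrow\Delta$ infer $w:A\supset B,\Gamma\Rightarrow\Delta$; $R\supset$: from $w:A,\Gamma\Rightarrow\Delta,w:B$ infer $\Gamma\Rightarrow\Delta,w:A\supset B$. Quantifiers: $L\forall$: from $w:A[y/x],y\in w,w:\forall xA,\Gamma\Rightarrow\Delta$ infer $y\in w,w:\forall xA,\Gamma\Rightarrow\Delta$; $R\forall$ ($z$ fresh): from $z\in w,\Gamma\Rightarrow\Delta,w:A[z/x]$ infer $\Gamma\Rightarrow\Delta,w:\forall xA$; $L\exists$ ($z$ fresh): from $z\in w,w:A[z/x],\Gamma\Rightarrow\Delta$ infer $w:\exists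 xA,\Gamma\Rightarrow\Delta$; $R\exists$: from $y\in w,\Gamma\Rightarrow\Delta,w:\exists xA,w:A[y/x]$ infer $y\in w,\Gamma\Rightarrow\Delta,w:\exists xA$. Modalities: $L\Box$: from $v:A,w\mathscr{R}v,w:\Box A,\Gamma\Rightarrow\Delta$ infer $w\mathscr{R}v,w:\Box A,\Gamma\Rightarrow\Delta$; $R\Box$ ($u$ fresh): from $w\mathscr{R}u,\Gamma\Rightarrow\Delta,u:A$ infer $\Gamma\Rightarrow\Delta,w:\Box A$; $L\Diamond$ ($u$ fresh): from $w\mathscr{R}u,u:A,\Gamma\Rightarrow\Delta$ infer $w:\Diamond A,\Gamma\Rightarrow\Delta$; $R\Diamond$: from $w\mathscr{R}v,\Gamma\Rightarrow\Delta,w:\Diamond A,v:A$ infer $w\mathscr{R}v,\Gamma\Rightarrow\Delta,w:\Diamond A$. Identity: $Ref_=$: from $w:x=x,\Gamma\Rightarrow\Delta$ infer $\Gamma\Rightarrow\Delta$; $RigVar$: from $v:y=z,w:y=z,\Gamma\Rightarrow\Delta$ infer $w:y=z,\Gamma\Rightarrow\Delta$; $Repl$: from $E[z/x],E[y/x],w:y=z,\Gamma\Rightarrow\Delta$ infer $E[y/x],w:y=z,\Gamma\Rightarrow\Delta$, where $E$ is a denotation formula with variable first argument and label $w$, a domain atom $x'\in w$, or a labelled atomic formula $w:p$. $\lambda$: $L\lambda$ ($z$ fresh): from $D(t,z,w),w:B[z/x],\Gamma\Rightarrow\Delta$ infer $w:\lambda xB.t,\Gamma\Rightarrow\Delta$;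 $R\lambda$: from $\Gamma\Rightarrow\Delta,w:\lambda xB.t,D(t,y,w)$ and $\Gamma\Rightarrow\Delta,w:\lambda xB.t,w:B[y/x]$ infer $\Gamma\Rightarrow\Delta,w:\lambda xB.t$. Denotation: $LD_1$: from $w:A[x_2/x_1],D(\iota x_1A,x_2,w),\Gamma\Rightarrow\Delta$ infer $D(\iota x_1A,x_2,w),\Gamma\Rightarrow\Delta$; $LD_2$: from $D(\iota x_1A,x_2,w),\Gamma\Rightarrow\Delta,w:A[y/x_1]$ and $w:x_2=y,D(\iota x_1A,x_2,w),\Gamma\Rightarrow\Delta$ infer $D(\iota x_1A,x_2,w),\Gamma\Rightarrow\Delta$; $RD$ ($z$ fresh): from $\Gamma\Rightarrow\Delta,w:A[x_2/x_1]$ and $w:A[z/x_1],\Gamma\Rightarrow\Delta,w:x_2=z$ infer $\Gamma\Rightarrow\Delta,D(\iota x_1A,x_2,w)$; $DenVar$: from $D(x,x,w),\Gamma\Rightarrow\Delta$ infer $\Gamma\Rightarrow\Delta$; $DenId$: from $w:y=x,D(y,x,w),\Gamma\Rightarrow\Delta$ infer $D(y,x,w),\Gamma\Rightarrow\Delta$ ($x,y$ variables). Non-logical rules: $Ref_\mathcal{W}$: from $w\mathscr{R}w,\Gamma\Rightarrow\Delta$ infer $\Gamma\Rightarrow\Delta$ (reflexivity); $Ser$ ($u$ fresh): from $w\mathscr{R}u,\Gamma\Rightarrow\Delta$ infer $\Gamma\Rightarrow\Delta$ (seriality); $Trans$: from $w\mathscr{R}u,w\mathscr{R}v,v\mathscr{R}u,\Gamma\Rightarrow\Delta$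 infer $w\mathscr{R}v,v\mathscr{R}u,\Gamma\Rightarrow\Delta$ (transitivity); $Eucl$: from $v\mathscr{R}u,w\mathscr{R}v,w\mathscr{R}u,\Gamma\Rightarrow\Delta$ infer $w\mathscr{R}v,w\mathscr{R}u,\Gamma\Rightarrow\Delta$, always together with $Eucl^c$: from $v\mathscr{R}v,w\mathscr{R}v,\Gamma\Rightarrow\Delta$ infer $w\mathscr{R}v,\Gamma\Rightarrow\Delta$ (Euclideanness); $Incr$: from $x\in v,x\in w,w\mathscr{R}v,\Gamma\Rightarrow\Delta$ infer $x\in w,w\mathscr{R}v,\Gamma\Rightarrow\Delta$ (increasing domains: $w\mathcal{R}v\Rightarrow D_w\subseteq D_v$); $Decr$: from $x\in w,x\in v,w\mathscr{R}v,\Gamma\Rightarrow\Delta$ infer $x\in v,w\mathscr{R}v,\Gamma\Rightarrow\Delta$ (decreasing domains); $Cons$: from $x\in w,\Gamma\Rightarrow\Delta$ infer $\Gamma\Rightarrow\Delta$ (constant domains: $w\mathcal{R}v\Rightarrow D_w=D_v$). For a set $N$ of these non-logical rules, $\mathbf{G3Q\lambda.L}=\mathbf{G3Q\lambda.K}+N$, and $\mathbf{Q\lambda.L}$ is the logic of the class of frames $\langle\mathcal{W},\mathcal{R},\mathcal{D}\rangle$ satisfying the corresponding properties; a model for $\mathbf{Q\lambda.L}$ is one based on such a frame. Derivations: trees of sequents with initial sequents at the leaves, built by the rules, of pure sequents (no variable both free and bound). $\Gamma\Rightarrow\Delta$ is derivable if it or an alphabetic variant has a derivation. Validity: for a model $\mathcal{M}$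 and $f$ mapping labels to worlds and variables to $D_\mathcal{W}$: $\mathcal{M}$ satisfies $w:A$ under $f$ iff $f\models_{f(w)}A$; $x\in w$ iff $f(x)\in D_{f(w)}$; $w\mathscr{R}v$ iff $f(w)\mathcal{R}f(v)$; $D(t,x,w)$ iff $f(t)=f(x)$ when $t$ is a variable, and, when $t\equiv\iota yA$, iff for all $o\in D_\mathcal{W}$: $f^{y\triangleright o}\models_{f(w)}A$ iff $o=f(x)$. $\Gamma\Rightarrow\Delta$ is $\mathbf{Q\lambda.L}$-valid iff for every model $\mathcal{M}$ for $\mathbf{Q\lambda.L}$ and every $f$, if $\mathcal{M}$ satisfies all of $\Gamma$ under $f$ then it satisfies some member of $\Delta$ under $f$. -}

module Defs where

open import Data.Nat using (ℕ; zero; suc)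
open import Data.Fin using (Fin; zero; suc)
open import Data.Vec using (Vec; []; _∷_; lookup)
import Data.Vec as Vec
open import Data.List using (List; []; _∷_; _++_; concatMap)
open import Data.List.Membership.Propositional using (_∈_; _∉_)
open import Data.List.Relation.Unary.All using (All)
open import Data.List.Relation.Unary.Any using (Any)
open import Data.List.Relation.Binary.Permutation.Propositional using (_↭_)
open import Data.Product using (Σ; ∃; _×_; _,_)
open import Data.Sum using (_⊎_)
open import Data.Empty using (⊥)
open import Data.Unit using (⊤)
open import Data.Bool using (Bool; T)
open import Relation.Binary.PropositionalEquality using (_≡_)
open import Relation.Nullary using (¬_)

record Sig : Set₁ where
  field
    Pred : Set
    ar   : Pred → ℕ
open Sig public

VarName : Set
VarName = ℕ

Label : Set
Label = ℕ

-- Locally nameless syntax of L^λ.  Formula n / Term n have n bound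
-- variables in scope (de Bruijn, Fin n); free variables are names.

data Var (n : ℕ) : Set where
  bv : Fin n → Var n
  fv : VarName → Var n

module _ (S : Sig) where

  mutual
    data Term (n : ℕ) : Set where
      var  : Var n → Term n
      iota : Formula (suc n) → Term n

    data Formula (n : ℕ) : Set where
      pred  : (P : Pred S) → Vec (Var n) (ar S P) → Formula n
      _≐_   : Var n → Var n → Formula n
      ⊥′    : Formula n
      _∧′_  : Formula n → Formula n → Formula n
      _∨′_  : Formula n → Formula n → Formula n
      _⊃_   : Formula n → Formula n → Formula n
      ∀′    : Formula (suc n) → Formula n
      ∃′    : Formula (suc n) → Formula n
      □     : Formula n → Formula n
      ◇     : Formula n → Formula n
      lam   : Formula (suc n) → Term n → Formula n  -- λ x A . t

  data Atomic {n : ℕ} : Formula n → Set where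
    atP  : ∀ P xs → Atomic (pred P xs)
    atEq : ∀ x y → Atomic (x ≐ y)

  wkV : ∀ {n} → Var n → Var (suc n)
  wkV (bv i) = bv (suc i)
  wkV (fv x) = fv x

  liftV : ∀ {m n} → (Var m → Var n) → Var (suc m) → Var (suc n)
  liftV f (bv zero)    = bv zero
  liftV f (bv (suc i)) = wkV (f (bv i))
  liftV f (fv x)       = wkV (f (fv x))

  mutual
    renT : ∀ {m n} → (Var m → Var n) → Term m → Term n
    renT f (var x)  = var (f x)
    renT f (iota A) = iota (renF (liftV f) A)

    renF : ∀ {m n} → (Var m → Var n) → Formula m → Formula n
    renF f (pred P xs) = pred P (Vec.map f xs)
    renF f (x ≐ y)     = f x ≐ f y
    renF f ⊥′          = ⊥′
    renF f (A ∧′ B)    = renF f A ∧′ renF f B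
    renF f (A ∨′ B)    = renF f A ∨′ renF f B
    renF f (A ⊃ B)     = renF f A ⊃ renF f B
    renF f (∀′ A)      = ∀′ (renF (liftV f) A)
    renF f (∃′ A)      = ∃′ (renF (liftV f) A)
    renF f (□ A)       = □ (renF f A)
    renF f (◇ A)       = ◇ (renF f A)
    renF f (lam A t)   = lam (renF (liftV f) A) (renT f t)

  instV : ∀ {n} → VarName → Var (suc n) → Var n
  instV y (bv zero)    = fv y
  instV y (bv (suc i)) = bv i
  instV y (fv x)       = fv x

  _⟨_⟩ : ∀ {n} → Formula (suc n) → VarName → Formula n
  A ⟨ y ⟩ = renF (instV y) A

  substV : ∀ {n} → VarName → VarName → Var n → Var n
  substV y x (bv i) = bv i
  substV y x (fv z) with z Data.Nat.≟ x
  ... | Relation.Nullary.yes _ = fv y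
  ... | Relation.Nullary.no  _ = fv z

  fvV : ∀ {n} → Var n → List VarName
  fvV (bv i) = []
  fvV (fv x) = x ∷ []

  mutual
    fvT : ∀ {n} → Term n → List VarName
    fvT (var x)  = fvV x
    fvT (iota A) = fvF A

    fvF : ∀ {n} → Formula n → List VarName
    fvF (pred P xs) = Vec.foldr (λ _ → List VarName) (λ x r → fvV x ++ r) [] xs
    fvF (x ≐ y)     = fvV x ++ fvV y
    fvF ⊥′          = []
    fvF (A ∧′ B)    = fvF A ++ fvF B
    fvF (A ∨′ B)    = fvF A ++ fvF B
    fvF (A ⊃ B)     = fvF A ++ fvF B
    fvF (∀′ A)      = fvF A
    fvF (∃′ A)      = fvF A
    fvF (□ A)       = fvF A
    fvF (◇ A)       = fvF A
    fvF (lam A t)   = fvF A ++ fvT t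

  data RExpr : Set where
    _∶_ : Label → Formula 0 → RExpr
    D   : Term 0 → VarName → Label → RExpr

  data LExpr : Set where
    ⌜_⌝  : RExpr → LExpr
    _∈ᵈ_ : VarName → Label → LExpr
    _ℛ_  : Label → Label → LExpr

  fvR : RExpr → List VarName
  fvR (w ∶ A)   = fvF A
  fvR (D t x w) = fvT t ++ x ∷ []

  fvL : LExpr → List VarName
  fvL ⌜ e ⌝    = fvR e
  fvL (x ∈ᵈ w) = x ∷ []
  fvL (w ℛ v)  = []

  lbR : RExpr → List Label
  lbR (w ∶ A)   = w ∷ []
  lbR (D t x w) = w ∷ []

  lbL : LExpr → List Label
  lbL ⌜ e ⌝    = lbR e
  lbL (x ∈ᵈ w) = w ∷ []
  lbL (w ℛ v)  = w ∷ v ∷ []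

  FreshVar : VarName → List LExpr → List RExpr → Set
  FreshVar z Γ Δ = z ∉ (concatMap fvL Γ ++ concatMap fvR Δ)

  FreshLab : Label → List LExpr → List RExpr → Set
  FreshLab u Γ Δ = u ∉ (concatMap lbL Γ ++ concatMap lbR Δ)

  substN : VarName → VarName → VarName → VarName
  substN y x v with v Data.Nat.≟ x
  ... | Relation.Nullary.yes _ = y
  ... | Relation.Nullary.no  _ = v

  substL : VarName → VarName → LExpr → LExpr
  substL y x ⌜ w ∶ A ⌝   = ⌜ w ∶ renF (substV y x) A ⌝
  substL y x ⌜ D t v w ⌝ = ⌜ D (renT (substV y x) t) (substN y x v) w ⌝
  substL y x (v ∈ᵈ w)    = substN y x v ∈ᵈ w
  substL y x (w ℛ v)     = w ℛ v

  data ReplExpr (w : Label) : LExpr → Set where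
    rDen  : ∀ a b → ReplExpr w ⌜ D (var (fv a)) b w ⌝
    rDom  : ∀ a → ReplExpr w (a ∈ᵈ w)
    rAtom : ∀ p → Atomic p → ReplExpr w ⌜ w ∶ p ⌝

  data NL : Set where
    refW ser trans eucl incr decr cons : NL

  RuleSet : Set
  RuleSet = NL → Bool

  -- The calculus G3Qλ.K + N.  Sequents are multisets, represented by
  -- lists together with the structural rule `perm` (reordering).

  infix 4 _⊢_⇒_
  data _⊢_⇒_ (N : RuleSet) : List LExpr → List RExpr → Set where
    perm : ∀ {Γ Γ′ Δ Δ′} → Γ ↭ Γ′ → Δ ↭ Δ′ → N ⊢ Γ ⇒ Δ → N ⊢ Γ′ ⇒ Δ′
    initAt  : ∀ {Γ Δ w p} → Atomic p → N ⊢ ⌜ w ∶ p ⌝ ∷ Γ ⇒ (w ∶ p) ∷ Δ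
    initD   : ∀ {Γ Δ y x w} → N ⊢ ⌜ D (var (fv y)) x w ⌝ ∷ Γ ⇒ D (var (fv y)) x w ∷ Δ
    init⊥   : ∀ {Γ Δ w} → N ⊢ ⌜ w ∶ ⊥′ ⌝ ∷ Γ ⇒ Δ
    L∧ : ∀ {Γ Δ w A B} → N ⊢ ⌜ w ∶ A ⌝ ∷ ⌜ w ∶ B ⌝ ∷ Γ ⇒ Δ → N ⊢ ⌜ w ∶ (A ∧′ B) ⌝ ∷ Γ ⇒ Δ
    R∧ : ∀ {Γ Δ w A B} → N ⊢ Γ ⇒ (w ∶ A) ∷ Δ → N ⊢ Γ ⇒ (w ∶ B) ∷ Δ → N ⊢ Γ ⇒ (w ∶ (A ∧′ B)) ∷ Δ
    L∨ : ∀ {Γ Δ w A B} → N ⊢ ⌜ w ∶ A ⌝ ∷ Γ ⇒ Δ → N ⊢ ⌜ w ∶ B ⌝ ∷ Γ ⇒ Δ → N ⊢ ⌜ w ∶ (A ∨′ B) ⌝ ∷ Γ ⇒ Δ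
    R∨ : ∀ {Γ Δ w A B} → N ⊢ Γ ⇒ (w ∶ A) ∷ (w ∶ B) ∷ Δ → N ⊢ Γ ⇒ (w ∶ (A ∨′ B)) ∷ Δ
    L⊃ : ∀ {Γ Δ w A B} → N ⊢ Γ ⇒ (w ∶ A) ∷ Δ → N ⊢ ⌜ w ∶ B ⌝ ∷ Γ ⇒ Δ → N ⊢ ⌜ w ∶ (A ⊃ B) ⌝ ∷ Γ ⇒ Δ
    R⊃ : ∀ {Γ Δ w A B} → N ⊢ ⌜ w ∶ A ⌝ ∷ Γ ⇒ (w ∶ B) ∷ Δ → N ⊢ Γ ⇒ (w ∶ (A ⊃ B)) ∷ Δ
    L∀ : ∀ {Γ Δ w A y} →
         N ⊢ ⌜ w ∶ (A ⟨ y ⟩) ⌝ ∷ (y ∈ᵈ w) ∷ ⌜ w ∶ ∀′ A ⌝ ∷ Γ ⇒ Δ →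
         N ⊢ (y ∈ᵈ w) ∷ ⌜ w ∶ ∀′ A ⌝ ∷ Γ ⇒ Δ
    R∀ : ∀ {Γ Δ w A z} → FreshVar z Γ ((w ∶ ∀′ A) ∷ Δ) →
         N ⊢ (z ∈ᵈ w) ∷ Γ ⇒ (w ∶ (A ⟨ z ⟩)) ∷ Δ →
         N ⊢ Γ ⇒ (w ∶ ∀′ A) ∷ Δ
    L∃ : ∀ {Γ Δ w A z} → FreshVar z (⌜ w ∶ ∃′ A ⌝ ∷ Γ) Δ →
         N ⊢ (z ∈ᵈ w) ∷ ⌜ w ∶ (A ⟨ z ⟩) ⌝ ∷ Γ ⇒ Δ →
         N ⊢ ⌜ w ∶ ∃′ A ⌝ ∷ Γ ⇒ Δ
    R∃ : ∀ {Γ Δ w A y} →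
         N ⊢ (y ∈ᵈ w) ∷ Γ ⇒ (w ∶ ∃′ A) ∷ (w ∶ (A ⟨ y ⟩)) ∷ Δ →
         N ⊢ (y ∈ᵈ w) ∷ Γ ⇒ (w ∶ ∃′ A) ∷ Δ
    L□ : ∀ {Γ Δ w v A} →
         N ⊢ ⌜ v ∶ A ⌝ ∷ (w ℛ v) ∷ ⌜ w ∶ □ A ⌝ ∷ Γ ⇒ Δ →
         N ⊢ (w ℛ v) ∷ ⌜ w ∶ □ A ⌝ ∷ Γ ⇒ Δ
    R□ : ∀ {Γ Δ w u A} → FreshLab u Γ ((w ∶ □ A) ∷ Δ) →
         N ⊢ (w ℛ u) ∷ Γ ⇒ (u ∶ A) ∷ Δ →
         N ⊢ Γ ⇒ (w ∶ □ A) ∷ Δ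
    L◇ : ∀ {Γ Δ w u A} → FreshLab u (⌜ w ∶ ◇ A ⌝ ∷ Γ) Δ →
         N ⊢ (w ℛ u) ∷ ⌜ u ∶ A ⌝ ∷ Γ ⇒ Δ →
         N ⊢ ⌜ w ∶ ◇ A ⌝ ∷ Γ ⇒ Δ
    R◇ : ∀ {Γ Δ w v A} →
         N ⊢ (w ℛ v) ∷ Γ ⇒ (w ∶ ◇ A) ∷ (v ∶ A) ∷ Δ →
         N ⊢ (w ℛ v) ∷ Γ ⇒ (w ∶ ◇ A) ∷ Δ
    Ref= : ∀ {Γ Δ w x} → N ⊢ ⌜ w ∶ (fv x ≐ fv x) ⌝ ∷ Γ ⇒ Δ → N ⊢ Γ ⇒ Δ
    RigVar : ∀ {Γ Δ w v y z} →
         N ⊢ ⌜ v ∶ (fv y ≐ fv z) ⌝ ∷ ⌜ w ∶ (fv y ≐ fv z) ⌝ ∷ Γ ⇒ Δ →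
         N ⊢ ⌜ w ∶ (fv y ≐ fv z) ⌝ ∷ Γ ⇒ Δ
    Repl : ∀ {Γ Δ w y z x E} → ReplExpr w E →
         N ⊢ substL z x E ∷ substL y x E ∷ ⌜ w ∶ (fv y ≐ fv z) ⌝ ∷ Γ ⇒ Δ →
         N ⊢ substL y x E ∷ ⌜ w ∶ (fv y ≐ fv z) ⌝ ∷ Γ ⇒ Δ
    Lλ : ∀ {Γ Δ w B t z} → FreshVar z (⌜ w ∶ lam B t ⌝ ∷ Γ) Δ →
         N ⊢ ⌜ D t z w ⌝ ∷ ⌜ w ∶ (B ⟨ z ⟩) ⌝ ∷ Γ ⇒ Δ →
         N ⊢ ⌜ w ∶ lam B t ⌝ ∷ Γ ⇒ Δ
    Rλ : ∀ {Γ Δ w B t y} →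
         N ⊢ Γ ⇒ (w ∶ lam B t) ∷ D t y w ∷ Δ →
         N ⊢ Γ ⇒ (w ∶ lam B t) ∷ (w ∶ (B ⟨ y ⟩)) ∷ Δ →
         N ⊢ Γ ⇒ (w ∶ lam B t) ∷ Δ
    LD₁ : ∀ {Γ Δ w A x₂} →
         N ⊢ ⌜ w ∶ (A ⟨ x₂ ⟩) ⌝ ∷ ⌜ D (iota A) x₂ w ⌝ ∷ Γ ⇒ Δ →
         N ⊢ ⌜ D (iota A) x₂ w ⌝ ∷ Γ ⇒ Δ
    LD₂ : ∀ {Γ Δ w A x₂ y} →
         N ⊢ ⌜ D (iota A) x₂ w ⌝ ∷ Γ ⇒ (w ∶ (A ⟨ y ⟩)) ∷ Δ →
         N ⊢ ⌜ w ∶ (fv x₂ ≐ fv y) ⌝ ∷ ⌜ D (iota A) x₂ w ⌝ ∷ Γ ⇒ Δ →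
         N ⊢ ⌜ D (iota A) x₂ w ⌝ ∷ Γ ⇒ Δ
    RD : ∀ {Γ Δ w A x₂ z} → FreshVar z Γ (D (iota A) x₂ w ∷ Δ) →
         N ⊢ Γ ⇒ (w ∶ (A ⟨ x₂ ⟩)) ∷ Δ →
         N ⊢ ⌜ w ∶ (A ⟨ z ⟩) ⌝ ∷ Γ ⇒ (w ∶ (fv x₂ ≐ fv z)) ∷ Δ →
         N ⊢ Γ ⇒ D (iota A) x₂ w ∷ Δ
    DenVar : ∀ {Γ Δ w x} → N ⊢ ⌜ D (var (fv x)) x w ⌝ ∷ Γ ⇒ Δ → N ⊢ Γ ⇒ Δ
    DenId : ∀ {Γ Δ w x y} →
         N ⊢ ⌜ w ∶ (fv y ≐ fv x) ⌝ ∷ ⌜ D (var (fv y)) x w ⌝ ∷ Γ ⇒ Δ →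
         N ⊢ ⌜ D (var (fv y)) x w ⌝ ∷ Γ ⇒ Δ
    RefW : ∀ {Γ Δ w} → T (N refW) → N ⊢ (w ℛ w) ∷ Γ ⇒ Δ → N ⊢ Γ ⇒ Δ
    Ser  : ∀ {Γ Δ w u} → T (N ser) → FreshLab u Γ Δ →
           N ⊢ (w ℛ u) ∷ Γ ⇒ Δ → N ⊢ Γ ⇒ Δ
    Trans : ∀ {Γ Δ w v u} → T (N trans) →
           N ⊢ (w ℛ u) ∷ (w ℛ v) ∷ (v ℛ u) ∷ Γ ⇒ Δ →
           N ⊢ (w ℛ v) ∷ (v ℛ u) ∷ Γ ⇒ Δ
    Eucl : ∀ {Γ Δ w v u} → T (N eucl) →
           N ⊢ (v ℛ u) ∷ (w ℛ v) ∷ (w ℛ u) ∷ Γ ⇒ Δ →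
           N ⊢ (w ℛ v) ∷ (w ℛ u) ∷ Γ ⇒ Δ
    Euclᶜ : ∀ {Γ Δ w v} → T (N eucl) →
           N ⊢ (v ℛ v) ∷ (w ℛ v) ∷ Γ ⇒ Δ →
           N ⊢ (w ℛ v) ∷ Γ ⇒ Δ
    Incr : ∀ {Γ Δ w v x} → T (N incr) →
           N ⊢ (x ∈ᵈ v) ∷ (x ∈ᵈ w) ∷ (w ℛ v) ∷ Γ ⇒ Δ →
           N ⊢ (x ∈ᵈ w) ∷ (w ℛ v) ∷ Γ ⇒ Δ
    Decr : ∀ {Γ Δ w v x} → T (N decr) →
           N ⊢ (x ∈ᵈ w) ∷ (x ∈ᵈ v) ∷ (w ℛ v) ∷ Γ ⇒ Δ →
           N ⊢ (x ∈ᵈ v) ∷ (w ℛ v) ∷ Γ ⇒ Δ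
    Cons : ∀ {Γ Δ w x} → T (N cons) →
           N ⊢ (x ∈ᵈ w) ∷ Γ ⇒ Δ → N ⊢ Γ ⇒ Δ

  record Model : Set₁ where
    field
      World : Set
      Rel   : World → World → Set
      Obj   : Set
      InDom : Obj → World → Set
      Val   : (P : Pred S) → World → Vec Obj (ar S P) → Set
      obj-in-some : ∀ o → ∃ λ w → InDom o w
      nonempty    : Obj

  module _ (M : Model) where
    open Model M

    evV : ∀ {n} → (VarName → Obj) → Vec Obj n → Var n → Obj
    evV σ ρ (bv i) = lookup ρ i
    evV σ ρ (fv x) = σ x

    mutual
      Den : ∀ {n} → (VarName → Obj) → Vec Obj n → World → Term n → Obj → Set
      Den σ ρ w (var x)  o = evV σ ρ x ≡ o
      Den σ ρ w (iota A) o = Sat σ (o ∷ ρ) w A × (∀ o′ → Sat σ (o′ ∷ ρ) w A → o′ ≡ o)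

      Sat : ∀ {n} → (VarName → Obj) → Vec Obj n → World → Formula n → Set
      Sat σ ρ w (pred P xs) = Val P w (Vec.map (evV σ ρ) xs)
      Sat σ ρ w (x ≐ y)     = evV σ ρ x ≡ evV σ ρ y
      Sat σ ρ w ⊥′          = ⊥
      Sat σ ρ w (A ∧′ B)    = Sat σ ρ w A × Sat σ ρ w B
      Sat σ ρ w (A ∨′ B)    = Sat σ ρ w A ⊎ Sat σ ρ w B
      Sat σ ρ w (A ⊃ B)     = Sat σ ρ w A → Sat σ ρ w B
      Sat σ ρ w (∀′ A)      = ∀ o → InDom o w → Sat σ (o ∷ ρ) w A
      Sat σ ρ w (∃′ A)      = ∃ λ o → InDom o w × Sat σ (o ∷ ρ) w A
      Sat σ ρ w (□ A)       = ∀ v → Rel w v → Sat σ ρ v A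
      Sat σ ρ w (◇ A)       = ∃ λ v → Rel w v × Sat σ ρ v A
      Sat σ ρ w (lam A t)   = ∃ λ o → Den σ ρ w t o × Sat σ (o ∷ ρ) w A

    SatR : (Label → World) → (VarName → Obj) → RExpr → Set
    SatR fl fv′ (w ∶ A)          = Sat fv′ [] (fl w) A
    SatR fl fv′ (D (var x) y w)  = evV fv′ [] x ≡ fv′ y
    SatR fl fv′ (D (iota A) y w) =
      ∀ o → (Sat fv′ (o ∷ []) (fl w) A → o ≡ fv′ y) × (o ≡ fv′ y → Sat fv′ (o ∷ []) (fl w) A)

    SatL : (Label → World) → (VarName → Obj) → LExpr → Set
    SatL fl fv′ ⌜ e ⌝    = SatR fl fv′ e
    SatL fl fv′ (x ∈ᵈ w) = InDom (fv′ x) (fl w)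
    SatL fl fv′ (w ℛ v)  = Rel (fl w) (fl v)

    FrameCond : NL → Set
    FrameCond refW  = ∀ w → Rel w w
    FrameCond ser   = ∀ w → ∃ λ v → Rel w v
    FrameCond trans = ∀ w v u → Rel w v → Rel v u → Rel w u
    FrameCond eucl  = ∀ w v u → Rel w v → Rel w u → Rel v u
    FrameCond incr  = ∀ w v o → Rel w v → InDom o w → InDom o v
    FrameCond decr  = ∀ w v o → Rel w v → InDom o v → InDom o w
    FrameCond cons  = ∀ w o → InDom o w

  IsModelFor : RuleSet → Model → Set
  IsModelFor N M = ∀ r → T (N r) → FrameCond M r

  Valid : RuleSet → List LExpr → List RExpr → Set₁
  Valid N Γ Δ = ∀ (M : Model) → IsModelFor N M →
                ∀ (fl : Label → Model.World M) (fv′ : VarName → Model.Obj M) →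
                All (SatL M fl fv′) Γ → Any (SatR M fl fv′) Δ

module Submission where

open import Defs hiding (trans)
open import Level using (Level)
open import Axiom.ExcludedMiddle using (ExcludedMiddle)
open import Data.List using (List)
open import Data.Nat using (ℕ)
open import Relation.Nullary using (¬_; Dec; yes; no)
open import Data.Empty using (⊥-elim)

-- Suppose Γ ⇒ Δ is not derivable. Starting from it, build a fair sequence of underivable sequents,
-- each obtained from its predecessor by applying a rule of G3Qλ.L backwards; for a branching rule,
-- excluded middle selects an underivable premise, and fresh variables and labels serve as the
-- eigenvariables. Since the calculus has neither weakening nor contraction, a sequent is kept as
-- a list of slots: a rule whose premises drop its principal expression empties that slot, and all
-- other expressions stay forever. Fairness makes the limit sequent Γω ⇒ Δω saturated.
--
-- The countermodel has the labels as worlds, the relational and domain atoms of Γω as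
-- accessibility and domains, and as objects the variables modulo the equations of Γω. A truth
-- lemma, by induction on size, shows that it satisfies Γω and falsifies Δω. For atomic formulas in
-- Δω this uses a finite stage containing a chain of equations: RigVar and Repl transport the atom
-- along the chain, which would close that stage. This contradicts the validity of Γ ⇒ Δ.

module Slots where

  open import Data.Nat using (ℕ; zero; suc; _≤_; _⊔_)
  open import Data.Nat.Properties using (≤-trans; m≤m⊔n; m≤n⊔m; n≮n)
  open import Data.List using (List; []; _∷_; _++_; map; catMaybes; fromMaybe)
  open import Data.List.Membership.Propositional using (_∈_; _∉_)
  open import Data.List.Membership.Propositional.Properties using (∈-∃++)
  open import Data.List.Relation.Unary.Any using (here; there)
  open import Data.List.Relation.Binary.Permutation.Propositional using (_↭_; ↭-refl; ↭-sym; ↭-trans; prep; swap)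
  open import Data.List.Relation.Binary.Permutation.Propositional.Properties using (shift)
  open import Data.Maybe using (Maybe; just; nothing)
  open import Data.Product using (∃; _,_)
  open import Data.Empty using (⊥-elim)
  open import Relation.Binary.PropositionalEquality

  private variable A : Set

  at : List A → ℕ → Maybe A
  at [] _ = nothing
  at (x ∷ xs) zero = just x
  at (x ∷ xs) (suc i) = at xs i

  setAt : List A → ℕ → A → List A
  setAt [] _ _ = []
  setAt (x ∷ xs) zero y = y ∷ xs
  setAt (x ∷ xs) (suc i) y = x ∷ setAt xs i y

  infix 4 _[_]↦_
  _[_]↦_ : List (Maybe A) → ℕ → A → Set
  xs [ i ]↦ x = at xs i ≡ just (just x)

  ↦-unique : ∀ (xs : List (Maybe A)) i {x y} → xs [ i ]↦ x → xs [ i ]↦ y → x ≡ y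
  ↦-unique xs i p q with trans (sym p) q
  ... | refl = refl

  at-++ : (xs ys : List A) (i : ℕ) {x : A} → at xs i ≡ just x → at (xs ++ ys) i ≡ just x
  at-++ (x ∷ xs) ys zero e = e
  at-++ (x ∷ xs) ys (suc i) e = at-++ xs ys i e

  at-setAt-≢ : (xs : List A) (i k : ℕ) (y : A) → k ≢ i → at (setAt xs i y) k ≡ at xs k
  at-setAt-≢ [] i k y k≢i = refl
  at-setAt-≢ (x ∷ xs) zero zero y k≢i = ⊥-elim (k≢i refl)
  at-setAt-≢ (x ∷ xs) zero (suc k) y k≢i = refl
  at-setAt-≢ (x ∷ xs) (suc i) zero y k≢i = refl
  at-setAt-≢ (x ∷ xs) (suc i) (suc k) y k≢i = at-setAt-≢ xs i k y (λ e → k≢i (cong suc e))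

  at-setAt-≡ : (xs : List A) (i : ℕ) {x : A} (y : A) → at xs i ≡ just x → at (setAt xs i y) i ≡ just y
  at-setAt-≡ (x ∷ xs) zero y e = refl
  at-setAt-≡ (x ∷ xs) (suc i) y e = at-setAt-≡ xs i y e

  catMaybes-++-just : (xs : List (Maybe A)) (ys : List A) → catMaybes (xs ++ map just ys) ≡ catMaybes xs ++ ys
  catMaybes-++-just [] [] = refl
  catMaybes-++-just [] (y ∷ ys) = cong (y ∷_) (catMaybes-++-just [] ys)
  catMaybes-++-just (just x ∷ xs) ys = cong (x ∷_) (catMaybes-++-just xs ys)
  catMaybes-++-just (nothing ∷ xs) ys = catMaybes-++-just xs ys

  catMaybes-map-just : (ys : List A) → catMaybes (map just ys) ≡ ys
  catMaybes-map-just ys = catMaybes-++-just [] ys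

  catMaybes-setAt : (xs : List (Maybe A)) (i : ℕ) {x : A} (m : Maybe A) → xs [ i ]↦ x →
                    catMaybes (setAt xs i m) ↭ fromMaybe m ++ catMaybes (setAt xs i nothing)
  catMaybes-setAt (just x ∷ xs) zero (just y) e = ↭-refl
  catMaybes-setAt (just x ∷ xs) zero nothing e = ↭-refl
  catMaybes-setAt (just z ∷ xs) (suc i) m e =
    ↭-trans (prep z (catMaybes-setAt xs i m e)) (↭-sym (shift z (fromMaybe m) _))
  catMaybes-setAt (nothing ∷ xs) (suc i) m e = catMaybes-setAt xs i m e

  catMaybes-↦ : (xs : List (Maybe A)) (i : ℕ) {x : A} → xs [ i ]↦ x →
                catMaybes xs ↭ x ∷ catMaybes (setAt xs i nothing)
  catMaybes-↦ (just x ∷ xs) zero refl = ↭-refl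
  catMaybes-↦ (just z ∷ xs) (suc i) e = ↭-trans (prep z (catMaybes-↦ xs i e)) (swap z _ ↭-refl)
  catMaybes-↦ (nothing ∷ xs) (suc i) e = catMaybes-↦ xs i e

  ∈-catMaybes⁻ : (xs : List (Maybe A)) {x : A} → x ∈ catMaybes xs → ∃ λ i → xs [ i ]↦ x
  ∈-catMaybes⁻ (just y ∷ xs) (here refl) = zero , refl
  ∈-catMaybes⁻ (just y ∷ xs) (there p) with ∈-catMaybes⁻ xs p
  ... | i , e = suc i , e
  ∈-catMaybes⁻ (nothing ∷ xs) p with ∈-catMaybes⁻ xs p
  ... | i , e = suc i , e

  ∈-catMaybes⁺ : (xs : List (Maybe A)) (i : ℕ) {x : A} → xs [ i ]↦ x → x ∈ catMaybes xs
  ∈-catMaybes⁺ (just y ∷ xs) zero refl = here refl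
  ∈-catMaybes⁺ (just y ∷ xs) (suc i) e = there (∈-catMaybes⁺ xs i e)
  ∈-catMaybes⁺ (nothing ∷ xs) (suc i) e = ∈-catMaybes⁺ xs i e

  ∈⇒↭∷ : {x : A} {xs : List A} → x ∈ xs → ∃ λ ys → xs ↭ x ∷ ys
  ∈⇒↭∷ {x = x} p with ∈-∃++ p
  ... | as , bs , refl = as ++ bs , shift x as bs

  maxList : List ℕ → ℕ
  maxList [] = 0
  maxList (x ∷ xs) = x ⊔ maxList xs

  ∈⇒≤maxList : ∀ {x} xs → x ∈ xs → x ≤ maxList xs
  ∈⇒≤maxList (y ∷ xs) (here refl) = m≤m⊔n y (maxList xs)
  ∈⇒≤maxList (y ∷ xs) (there p) = ≤-trans (∈⇒≤maxList xs p) (m≤n⊔m y (maxList xs))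

  suc-maxList-∉ : ∀ xs → suc (maxList xs) ∉ xs
  suc-maxList-∉ xs p = n≮n _ (∈⇒≤maxList xs p)

module Enumeration where

  open import Data.Nat using (ℕ; zero; suc; _+_; _≤_; z≤n; s≤s)
  open import Data.Nat.Properties using (≤-trans; ≤-reflexive; n≤1+n; +-suc; +-identityʳ; suc-injective)
  open import Data.Product using (∃; _×_; _,_; proj₁; proj₂)
  open import Relation.Binary.PropositionalEquality

  next : ℕ × ℕ → ℕ × ℕ
  next (i , zero) = zero , suc i
  next (i , suc d) = suc i , d

  -- Walks the antidiagonals i + d = 0, 1, 2, … of ℕ × ℕ.
  unpair : ℕ → ℕ × ℕ
  unpair zero = 0 , 0
  unpair (suc n) = next (unpair n)

  unpair-sum≤ : ∀ n → proj₁ (unpair n) + proj₂ (unpair n) ≤ n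
  unpair-sum≤ zero = z≤n
  unpair-sum≤ (suc n) with unpair n | unpair-sum≤ n
  ... | i , zero | h = s≤s (≤-trans (≤-reflexive (sym (+-identityʳ i))) h)
  ... | i , suc d | h = s≤s (≤-trans (n≤1+n _) (≤-trans (≤-reflexive (sym (+-suc i d))) h))

  private
    unpair-onto : ∀ b i d → i + d ≡ b → ∃ λ n → unpair n ≡ (i , d)
    unpair-onto zero zero zero e = 0 , refl
    unpair-onto b (suc i) d e with unpair-onto b i (suc d) (trans (+-suc i d) e)
    ... | n , q = suc n , cong next q
    unpair-onto (suc b) zero (suc d) e with unpair-onto b b zero (+-identityʳ b)
    ... | n , q = suc n , trans (cong next q) (cong (λ z → zero , suc z) (sym (suc-injective e)))

  unpair-surjective : ∀ i d → ∃ λ n → unpair n ≡ (i , d)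
  unpair-surjective i d = unpair-onto (i + d) i d refl

module Minimisation where

  open import Data.Nat using (zero; suc; _≤_; _<_)
  open import Data.Nat.Properties using (≮⇒≥; n<1+n; m<1+n⇒m<n∨m≡n)
  open import Data.Sum using (_⊎_; inj₁; inj₂)
  open import Data.Empty using (⊥-elim)
  open import Relation.Binary.PropositionalEquality using (refl)
  open import Relation.Nullary using (yes; no)

  record Least (P : ℕ → Set) : Set where
    field
      value   : ℕ
      holds   : P value
      minimal : ∀ {k} → P k → value ≤ k

  module _ {P : ℕ → Set} (P? : ∀ n → Dec (P n)) where

    private
      search : ∀ n → Least P ⊎ (∀ {k} → k < n → ¬ P k)
      search zero = inj₂ λ ()
      search (suc n) with search n
      ... | inj₁ l = inj₁ l
      ... | inj₂ none with P? n
      ...   | yes p = inj₁ (record { value = n ; holds = p ; minimal = λ pk → ≮⇒≥ (λ k<n → none k<n pk) })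
      ...   | no ¬p = inj₂ below
        where
        below : ∀ {k} → k < suc n → ¬ P k
        below k<1+n with m<1+n⇒m<n∨m≡n k<1+n
        ... | inj₁ k<n = none k<n
        ... | inj₂ refl = ¬p

    least : ∀ {n} → P n → Least P
    least {n} pn with search (suc n)
    ... | inj₁ l = l
    ... | inj₂ none = ⊥-elim (none (n<1+n n) pn)

module Syntax (S : Sig) where

  open import Data.Nat using (suc; _+_; _≟_)
  open import Data.Fin using (zero; suc)
  open import Data.Vec using (Vec; []; _∷_)
  import Data.Vec as Vec
  open import Data.Product using (_×_; _,_; proj₁; proj₂)
  open import Data.Sum using (inj₁; inj₂)
  open import Data.Empty using (⊥-elim)
  open import Relation.Binary.PropositionalEquality
  open import Relation.Nullary using (yes; no)

  mutual
    sizeT : ∀ {n} → Term S n → ℕ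
    sizeT (var x) = 1
    sizeT (iota A) = suc (sizeF A)

    sizeF : ∀ {n} → Formula S n → ℕ
    sizeF (pred P xs) = 1
    sizeF (x ≐ y) = 1
    sizeF ⊥′ = 1
    sizeF (A ∧′ B) = suc (sizeF A + sizeF B)
    sizeF (A ∨′ B) = suc (sizeF A + sizeF B)
    sizeF (A ⊃ B) = suc (sizeF A + sizeF B)
    sizeF (∀′ A) = suc (sizeF A)
    sizeF (∃′ A) = suc (sizeF A)
    sizeF (□ A) = suc (sizeF A)
    sizeF (◇ A) = suc (sizeF A)
    sizeF (lam A t) = suc (sizeF A + sizeT t)

  mutual
    sizeT-renT : ∀ {m n} (f : Var m → Var n) (t : Term S m) → sizeT (renT S f t) ≡ sizeT t
    sizeT-renT f (var x) = refl
    sizeT-renT f (iota A) = cong suc (sizeF-renF (liftV S f) A)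

    sizeF-renF : ∀ {m n} (f : Var m → Var n) (A : Formula S m) → sizeF (renF S f A) ≡ sizeF A
    sizeF-renF f (pred P xs) = refl
    sizeF-renF f (x ≐ y) = refl
    sizeF-renF f ⊥′ = refl
    sizeF-renF f (A ∧′ B) = cong suc (cong₂ _+_ (sizeF-renF f A) (sizeF-renF f B))
    sizeF-renF f (A ∨′ B) = cong suc (cong₂ _+_ (sizeF-renF f A) (sizeF-renF f B))
    sizeF-renF f (A ⊃ B) = cong suc (cong₂ _+_ (sizeF-renF f A) (sizeF-renF f B))
    sizeF-renF f (∀′ A) = cong suc (sizeF-renF (liftV S f) A)
    sizeF-renF f (∃′ A) = cong suc (sizeF-renF (liftV S f) A)
    sizeF-renF f (□ A) = cong suc (sizeF-renF f A)
    sizeF-renF f (◇ A) = cong suc (sizeF-renF f A)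
    sizeF-renF f (lam A t) = cong suc (cong₂ _+_ (sizeF-renF (liftV S f) A) (sizeT-renT f t))

  sizeF-⟨⟩ : (A : Formula S 1) (y : ℕ) → sizeF (_⟨_⟩ S A y) ≡ sizeF A
  sizeF-⟨⟩ A y = sizeF-renF (instV S y) A

  substV-hit : ∀ {n} y x → substV S {n} y x (fv x) ≡ fv y
  substV-hit y x with x ≟ x
  ... | yes _ = refl
  ... | no x≢x = ⊥-elim (x≢x refl)

  substV-miss : ∀ {n} y x z → z ≢ x → substV S {n} y x (fv z) ≡ fv z
  substV-miss y x z z≢x with z ≟ x
  ... | yes z≡x = ⊥-elim (z≢x z≡x)
  ... | no _ = refl

  substN-hit : ∀ y x → substN S y x x ≡ y
  substN-hit y x with x ≟ x
  ... | yes _ = refl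
  ... | no x≢x = ⊥-elim (x≢x refl)

  _⇔_ : Set → Set → Set
  A ⇔ B = (A → B) × (B → A)

  module Semantics (M : Model S) where
    open Model M

    ev : ∀ {n} → (VarName → Obj) → Vec Obj n → Var n → Obj
    ev = evV S M

    Preserves : ∀ {m n} → (Var m → Var n) → (VarName → Obj) → Vec Obj n → Vec Obj m → Set
    Preserves f σ ρ ρ′ = ∀ v → ev σ ρ (f v) ≡ ev σ ρ′ v

    Preserves-liftV : ∀ {m n} {f : Var m → Var n} {σ ρ ρ′} → Preserves f σ ρ ρ′ →
                      ∀ o → Preserves (liftV S f) σ (o ∷ ρ) (o ∷ ρ′)
    Preserves-liftV h o (bv zero) = refl
    Preserves-liftV {f = f} h o (bv (suc i)) with f (bv i) | h (bv i)
    ... | bv j | e = e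
    ... | fv x | e = e
    Preserves-liftV {f = f} h o (fv x) with f (fv x) | h (fv x)
    ... | bv j | e = e
    ... | fv y | e = e

    map-ev-Preserves : ∀ {m n k} {f : Var m → Var n} {σ ρ ρ′} → Preserves f σ ρ ρ′ →
                       (xs : Vec (Var m) k) → Vec.map (ev σ ρ) (Vec.map f xs) ≡ Vec.map (ev σ ρ′) xs
    map-ev-Preserves h [] = refl
    map-ev-Preserves h (x ∷ xs) = cong₂ _∷_ (h x) (map-ev-Preserves h xs)

    mutual
      Den-renT : ∀ {m n} {f : Var m → Var n} {σ ρ ρ′} → Preserves f σ ρ ρ′ →
                 ∀ w (t : Term S m) o → Den S M σ ρ w (renT S f t) o ⇔ Den S M σ ρ′ w t o
      Den-renT h w (var x) o = trans (sym (h x)) , trans (h x)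
      Den-renT {f = f} h w (iota A) o =
        (λ { (s , u) → proj₁ (IH o) s , λ o′ s′ → u o′ (proj₂ (IH o′) s′) }) ,
        (λ { (s , u) → proj₂ (IH o) s , λ o′ s′ → u o′ (proj₁ (IH o′) s′) })
        where IH = λ o → Sat-renF (Preserves-liftV h o) w A

      Sat-renF : ∀ {m n} {f : Var m → Var n} {σ ρ ρ′} → Preserves f σ ρ ρ′ →
                 ∀ w (A : Formula S m) → Sat S M σ ρ w (renF S f A) ⇔ Sat S M σ ρ′ w A
      Sat-renF h w (pred P xs) =
        subst (Val P w) (map-ev-Preserves h xs) , subst (Val P w) (sym (map-ev-Preserves h xs))
      Sat-renF h w (x ≐ y) =
        (λ e → trans (sym (h x)) (trans e (h y))) , (λ e → trans (h x) (trans e (sym (h y))))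
      Sat-renF h w ⊥′ = (λ z → z) , (λ z → z)
      Sat-renF h w (A ∧′ B) =
        (λ { (a , b) → proj₁ IHA a , proj₁ IHB b }) , (λ { (a , b) → proj₂ IHA a , proj₂ IHB b })
        where IHA = Sat-renF h w A; IHB = Sat-renF h w B
      Sat-renF h w (A ∨′ B) =
        (λ { (inj₁ a) → inj₁ (proj₁ IHA a) ; (inj₂ b) → inj₂ (proj₁ IHB b) }) ,
        (λ { (inj₁ a) → inj₁ (proj₂ IHA a) ; (inj₂ b) → inj₂ (proj₂ IHB b) })
        where IHA = Sat-renF h w A; IHB = Sat-renF h w B
      Sat-renF h w (A ⊃ B) =
        (λ g a → proj₁ IHB (g (proj₂ IHA a))) , (λ g a → proj₂ IHB (g (proj₁ IHA a)))
        where IHA = Sat-renF h w A; IHB = Sat-renF h w B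
      Sat-renF h w (∀′ A) = (λ g o d → proj₁ (IH o) (g o d)) , (λ g o d → proj₂ (IH o) (g o d))
        where IH = λ o → Sat-renF (Preserves-liftV h o) w A
      Sat-renF h w (∃′ A) =
        (λ { (o , d , s) → o , d , proj₁ (IH o) s }) , (λ { (o , d , s) → o , d , proj₂ (IH o) s })
        where IH = λ o → Sat-renF (Preserves-liftV h o) w A
      Sat-renF h w (□ A) =
        (λ g v r → proj₁ (IH v) (g v r)) , (λ g v r → proj₂ (IH v) (g v r))
        where IH = λ v → Sat-renF h v A
      Sat-renF h w (◇ A) =
        (λ { (v , r , s) → v , r , proj₁ (IH v) s }) , (λ { (v , r , s) → v , r , proj₂ (IH v) s })
        where IH = λ v → Sat-renF h v A
      Sat-renF h w (lam A t) =
        (λ { (o , d , s) → o , proj₁ (IHt o) d , proj₁ (IH o) s }) ,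
        (λ { (o , d , s) → o , proj₂ (IHt o) d , proj₂ (IH o) s })
        where IH = λ o → Sat-renF (Preserves-liftV h o) w A
              IHt = λ o → Den-renT h w t o

    Preserves-instV : ∀ {n} σ (ρ : Vec Obj n) y → Preserves (instV S y) σ ρ (σ y ∷ ρ)
    Preserves-instV σ ρ y (bv zero) = refl
    Preserves-instV σ ρ y (bv (suc i)) = refl
    Preserves-instV σ ρ y (fv x) = refl

    Sat-⟨⟩ : ∀ σ w (A : Formula S 1) y → Sat S M σ [] w (_⟨_⟩ S A y) ⇔ Sat S M σ (σ y ∷ []) w A
    Sat-⟨⟩ σ w A y = Sat-renF (Preserves-instV σ [] y) w A

module Reduction (lem : ∀ {ℓ : Level} → ExcludedMiddle ℓ) (S : Sig) (N : RuleSet S) where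

  open Slots
  open import Data.Nat using (suc; _≟_)
  open import Data.Nat.Properties using (≟-diag)
  open import Data.List using ([]; _∷_; _++_; map; concatMap; catMaybes; fromMaybe)
  open import Data.List.Membership.Propositional using (_∈_)
  open import Data.List.Membership.Propositional.Properties using (∈-++⁺ʳ)
  open import Data.List.Relation.Unary.Any using (here)
  open import Data.List.Relation.Binary.Subset.Propositional using (_⊆_)
  open import Data.List.Relation.Binary.Subset.Propositional.Properties
    using (⊆-reflexive-↭; concatMap⁺) renaming (++⁺ to ++⁺-⊆)
  open import Data.List.Relation.Binary.Permutation.Propositional
    using (_↭_; ↭-refl; ↭-sym; ↭-trans; ↭-reflexive; prep; swap)
  open import Data.List.Relation.Binary.Permutation.Propositional.Properties using (++-comm; ++-assoc; ++⁺ʳ; ++⁺ˡ)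
  open import Data.Maybe using (Maybe; just; nothing)
  open import Data.Product using (Σ; ∃; _×_; _,_; proj₁; proj₂)
  open import Data.Sum using (_⊎_; inj₁; inj₂)
  open import Data.Empty using (⊥-elim)
  open import Data.Unit using (⊤; tt)
  open import Data.Bool using (T; T?)
  open import Defs using () renaming (trans to trans′)
  open import Relation.Binary.PropositionalEquality
  open import Relation.Nullary using (yes; no)

  LE : Set
  LE = LExpr S

  RE : Set
  RE = RExpr S

  infixl 25 _⟪_⟫
  _⟪_⟫ : Formula S 1 → ℕ → Formula S 0
  A ⟪ y ⟫ = _⟨_⟩ S A y

  Der : List LE → List RE → Set
  Der Γ Δ = _⊢_⇒_ S N Γ Δ

  permL : ∀ {Γ Γ′ Δ} → Γ ↭ Γ′ → Der Γ Δ → Der Γ′ Δ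
  permL p = perm p ↭-refl

  permR : ∀ {Γ Δ Δ′} → Δ ↭ Δ′ → Der Γ Δ → Der Γ Δ′
  permR = perm ↭-refl

  underivablePremise : {P₁ P₂ C : Set} → (P₁ → P₂ → C) → ¬ C → (¬ P₁) ⊎ (¬ P₂)
  underivablePremise {P₁} rule ¬c with lem {P = P₁}
  ... | yes p₁ = inj₂ (λ p₂ → ¬c (rule p₁ p₂))
  ... | no ¬p₁ = inj₁ ¬p₁

  data Kind : Set where
    kL∧ kL∨ kL⊃ kL∀ kL∃ kL□ kL◇ kLλ kLD₁ kLD₂ kDenId : Kind
    kR∧ kR∨ kR⊃ kR∀ kR∃ kR□ kR◇ kRλ kRD : Kind
    kRefW kSer kTrans kEucl kIncr kDecr kCons kNoop : Kind

  -- The rule, if any, whose premises no longer contain this principal expression: applying it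
  -- empties the expression's slot. Every other expression keeps its slot forever.
  consumedByL : LE → Maybe Kind
  consumedByL ⌜ w ∶ (A ∧′ B) ⌝ = just kL∧
  consumedByL ⌜ w ∶ (A ∨′ B) ⌝ = just kL∨
  consumedByL ⌜ w ∶ (A ⊃ B) ⌝ = just kL⊃
  consumedByL ⌜ w ∶ ∃′ A ⌝ = just kL∃
  consumedByL ⌜ w ∶ ◇ A ⌝ = just kL◇
  consumedByL ⌜ w ∶ lam B t ⌝ = just kLλ
  consumedByL _ = nothing

  consumedByR : RE → Maybe Kind
  consumedByR (w ∶ (A ∧′ B)) = just kR∧
  consumedByR (w ∶ (A ∨′ B)) = just kR∨
  consumedByR (w ∶ (A ⊃ B)) = just kR⊃
  consumedByR (w ∶ ∀′ A) = just kR∀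
  consumedByR (w ∶ □ A) = just kR□
  consumedByR (D (iota A) x w) = just kRD
  consumedByR _ = nothing

  -- (K , i , k): apply rule K to the expression in slot i, with k the second slot or the parameter.
  Task : Set
  Task = Kind × ℕ × ℕ

  record State : Set where
    constructor state
    field
      anteSlots : List (Maybe LE)
      succSlots : List (Maybe RE)
      underivable : ¬ Der (catMaybes anteSlots) (catMaybes succSlots)
  open State public

  antecedent : State → List LE
  antecedent st = catMaybes (anteSlots st)

  succedent : State → List RE
  succedent st = catMaybes (succSlots st)

  SlotL : State → ℕ → LE → Set
  SlotL st i e = anteSlots st [ i ]↦ e

  SlotR : State → ℕ → RE → Set
  SlotR st j e = succSlots st [ j ]↦ e

  infix 4 _∈L_ _∈R_
  _∈L_ : LE → State → Set
  e ∈L st = ∃ λ i → SlotL st i e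

  _∈R_ : RE → State → Set
  e ∈R st = ∃ λ j → SlotR st j e

  freshVar : State → ℕ
  freshVar st = suc (maxList (concatMap (fvL S) (antecedent st) ++ concatMap (fvR S) (succedent st)))

  freshLabel : State → ℕ
  freshLabel st = suc (maxList (concatMap (lbL S) (antecedent st) ++ concatMap (lbR S) (succedent st)))

  freshVar-fresh : ∀ st {Γ Δ} → Γ ⊆ antecedent st → Δ ⊆ succedent st → FreshVar S (freshVar st) Γ Δ
  freshVar-fresh st Γ⊆ Δ⊆ z∈ =
    suc-maxList-∉ _ (++⁺-⊆ (concatMap⁺ (fvL S) Γ⊆) (concatMap⁺ (fvR S) Δ⊆) z∈)

  freshLabel-fresh : ∀ st {Γ Δ} → Γ ⊆ antecedent st → Δ ⊆ succedent st → FreshLab S (freshLabel st) Γ Δ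
  freshLabel-fresh st Γ⊆ Δ⊆ u∈ =
    suc-maxList-∉ _ (++⁺-⊆ (concatMap⁺ (lbL S) Γ⊆) (concatMap⁺ (lbR S) Δ⊆) u∈)

  catMaybes-++-just-↭ : ∀ {A : Set} (xs : List (Maybe A)) (X : List A) → catMaybes (xs ++ map just X) ↭ X ++ catMaybes xs
  catMaybes-++-just-↭ xs X = ↭-trans (↭-reflexive (catMaybes-++-just xs X)) (++-comm (catMaybes xs) X)

  ↦-++-appended : ∀ {A : Set} (xs : List (Maybe A)) (X : List A) {x} → x ∈ X → ∃ λ k → (xs ++ map just X) [ k ]↦ x
  ↦-++-appended xs X {x} p =
    ∈-catMaybes⁻ (xs ++ map just X) (subst (x ∈_) (sym (catMaybes-++-just xs X)) (∈-++⁺ʳ (catMaybes xs) p))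

  record Appended (st st′ : State) (X : List LE) (Y : List RE) : Set where
    field
      keepsL : ∀ {k e} → SlotL st k e → SlotL st′ k e
      keepsR : ∀ {k e} → SlotR st k e → SlotR st′ k e
      addedL : ∀ {x} → x ∈ X → x ∈L st′
      addedR : ∀ {y} → y ∈ Y → y ∈R st′

  appendUnderivable : (st : State) (X : List LE) (Y : List RE) →
                      ¬ Der (X ++ antecedent st) (Y ++ succedent st) → Σ State λ st′ → Appended st st′ X Y
  appendUnderivable st X Y ¬d =
    state (anteSlots st ++ map just X) (succSlots st ++ map just Y)
      (λ d → ¬d (perm (catMaybes-++-just-↭ (anteSlots st) X) (catMaybes-++-just-↭ (succSlots st) Y) d)) ,
    record { keepsL = λ {k} → at-++ (anteSlots st) (map just X) k
           ; keepsR = λ {k} → at-++ (succSlots st) (map just Y) k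
           ; addedL = ↦-++-appended (anteSlots st) X
           ; addedR = ↦-++-appended (succSlots st) Y }

  append : (st : State) (X : List LE) (Y : List RE) →
           (Der (X ++ antecedent st) (Y ++ succedent st) → Der (antecedent st) (succedent st)) →
           Σ State λ st′ → Appended st st′ X Y
  append st X Y rule = appendUnderivable st X Y (λ d → underivable st (rule d))

  appendOneOf : (st : State) (X₁ : List LE) (Y₁ : List RE) (X₂ : List LE) (Y₂ : List RE) →
                (Der (X₁ ++ antecedent st) (Y₁ ++ succedent st) → Der (X₂ ++ antecedent st) (Y₂ ++ succedent st) →
                 Der (antecedent st) (succedent st)) →
                Σ State λ st′ → Appended st st′ X₁ Y₁ ⊎ Appended st st′ X₂ Y₂
  appendOneOf st X₁ Y₁ X₂ Y₂ rule with underivablePremise rule (underivable st)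
  ... | inj₁ ¬d₁ = let (st′ , a) = appendUnderivable st X₁ Y₁ ¬d₁ in st′ , inj₁ a
  ... | inj₂ ¬d₂ = let (st′ , a) = appendUnderivable st X₂ Y₂ ¬d₂ in st′ , inj₂ a

  antecedent∖ : State → ℕ → List LE
  antecedent∖ st i = catMaybes (setAt (anteSlots st) i nothing)

  succedent∖ : State → ℕ → List RE
  succedent∖ st j = catMaybes (setAt (succSlots st) j nothing)

  antecedent-↦ : ∀ st i {e} → SlotL st i e → antecedent st ↭ e ∷ antecedent∖ st i
  antecedent-↦ st i = catMaybes-↦ (anteSlots st) i

  succedent-↦ : ∀ st j {e} → SlotR st j e → succedent st ↭ e ∷ succedent∖ st j
  succedent-↦ st j = catMaybes-↦ (succSlots st) j

  antecedent∖₂ : State → ℕ → ℕ → List LE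
  antecedent∖₂ st i k = catMaybes (setAt (setAt (anteSlots st) i nothing) k nothing)

  antecedent-↦₂ : ∀ st i k {a b} → SlotL st i a → SlotL st k b → k ≢ i →
                  antecedent st ↭ a ∷ b ∷ antecedent∖₂ st i k
  antecedent-↦₂ st i k sa sb k≢i =
    ↭-trans (antecedent-↦ st i sa)
            (prep _ (catMaybes-↦ (setAt (anteSlots st) i nothing) k (trans (at-setAt-≢ (anteSlots st) i k nothing k≢i) sb)))

  ⊆-antecedent-↦ : ∀ st i {e} → SlotL st i e → e ∷ antecedent∖ st i ⊆ antecedent st
  ⊆-antecedent-↦ st i s = ⊆-reflexive-↭ (↭-sym (antecedent-↦ st i s))

  ⊆-succedent-↦ : ∀ st j {e} → SlotR st j e → e ∷ succedent∖ st j ⊆ succedent st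
  ⊆-succedent-↦ st j s = ⊆-reflexive-↭ (↭-sym (succedent-↦ st j s))

  catMaybes-setAt-++ : ∀ {A : Set} (xs : List (Maybe A)) i {e : A} (m : Maybe A) (X : List A) → xs [ i ]↦ e →
                       catMaybes (setAt xs i m ++ map just X) ↭ fromMaybe m ++ X ++ catMaybes (setAt xs i nothing)
  catMaybes-setAt-++ xs i m X s =
    ↭-trans (↭-reflexive (catMaybes-++-just (setAt xs i m) X))
    (↭-trans (++⁺ʳ X (catMaybes-setAt xs i m s))
    (↭-trans (++-assoc (fromMaybe m) _ X) (++⁺ˡ (fromMaybe m) (++-comm _ X))))

  ↦-setAt-++-old : ∀ {A : Set} (xs : List (Maybe A)) i (m : Maybe A) (X : List A) k {e} → xs [ k ]↦ e →
                   (setAt xs i m ++ map just X) [ k ]↦ e ⊎ k ≡ i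
  ↦-setAt-++-old xs i m X k s with k ≟ i
  ... | yes k≡i = inj₂ k≡i
  ... | no k≢i = inj₁ (at-++ (setAt xs i m) (map just X) k (trans (at-setAt-≢ xs i k m k≢i) s))

  ↦-setAt-++-new : ∀ {A : Set} (xs : List (Maybe A)) i (m : Maybe A) (X : List A) {e x} → xs [ i ]↦ e →
                   x ∈ fromMaybe m → (setAt xs i m ++ map just X) [ i ]↦ x
  ↦-setAt-++-new xs i (just y) X s (here refl) = at-++ (setAt xs i (just y)) (map just X) i (at-setAt-≡ xs i (just y) s)

  record ReplacedL (st st′ : State) (i : ℕ) (m : Maybe LE) (X : List LE) (Y : List RE) : Set where
    field
      keepsL : ∀ {k e} → SlotL st k e → SlotL st′ k e ⊎ k ≡ i
      keepsR : ∀ {k e} → SlotR st k e → SlotR st′ k e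
      newL   : ∀ {x} → x ∈ fromMaybe m → x ∈L st′
      addedL : ∀ {x} → x ∈ X → x ∈L st′
      addedR : ∀ {y} → y ∈ Y → y ∈R st′

  record ReplacedR (st st′ : State) (j : ℕ) (m : Maybe RE) (X : List LE) (Y : List RE) : Set where
    field
      keepsL : ∀ {k e} → SlotL st k e → SlotL st′ k e
      keepsR : ∀ {k e} → SlotR st k e → SlotR st′ k e ⊎ k ≡ j
      newR   : ∀ {y} → y ∈ fromMaybe m → y ∈R st′
      addedL : ∀ {x} → x ∈ X → x ∈L st′
      addedR : ∀ {y} → y ∈ Y → y ∈R st′

  replaceLUnderivable : (st : State) (i : ℕ) {e : LE} → SlotL st i e → (m : Maybe LE) (X : List LE) (Y : List RE) →
                        ¬ Der (fromMaybe m ++ X ++ antecedent∖ st i) (Y ++ succedent st) →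
                        Σ State λ st′ → ReplacedL st st′ i m X Y
  replaceLUnderivable st i s m X Y ¬d =
    state (setAt (anteSlots st) i m ++ map just X) (succSlots st ++ map just Y)
      (λ d → ¬d (perm (catMaybes-setAt-++ (anteSlots st) i m X s) (catMaybes-++-just-↭ (succSlots st) Y) d)) ,
    record { keepsL = λ {k} → ↦-setAt-++-old (anteSlots st) i m X k
           ; keepsR = λ {k} → at-++ (succSlots st) (map just Y) k
           ; newL = λ p → i , ↦-setAt-++-new (anteSlots st) i m X s p
           ; addedL = ↦-++-appended (setAt (anteSlots st) i m) X
           ; addedR = ↦-++-appended (succSlots st) Y }

  replaceRUnderivable : (st : State) (j : ℕ) {e : RE} → SlotR st j e → (m : Maybe RE) (X : List LE) (Y : List RE) →
                        ¬ Der (X ++ antecedent st) (fromMaybe m ++ Y ++ succedent∖ st j) →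
                        Σ State λ st′ → ReplacedR st st′ j m X Y
  replaceRUnderivable st j s m X Y ¬d =
    state (anteSlots st ++ map just X) (setAt (succSlots st) j m ++ map just Y)
      (λ d → ¬d (perm (catMaybes-++-just-↭ (anteSlots st) X) (catMaybes-setAt-++ (succSlots st) j m Y s) d)) ,
    record { keepsL = λ {k} → at-++ (anteSlots st) (map just X) k
           ; keepsR = λ {k} → ↦-setAt-++-old (succSlots st) j m Y k
           ; newR = λ p → j , ↦-setAt-++-new (succSlots st) j m Y s p
           ; addedL = ↦-++-appended (anteSlots st) X
           ; addedR = ↦-++-appended (setAt (succSlots st) j m) Y }

  replaceL : (st : State) (i : ℕ) {e : LE} → SlotL st i e → (m : Maybe LE) (X : List LE) (Y : List RE) →
             (Der (fromMaybe m ++ X ++ antecedent∖ st i) (Y ++ succedent st) → Der (e ∷ antecedent∖ st i) (succedent st)) →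
             Σ State λ st′ → ReplacedL st st′ i m X Y
  replaceL st i s m X Y rule =
    replaceLUnderivable st i s m X Y (λ d → underivable st (permL (↭-sym (antecedent-↦ st i s)) (rule d)))

  replaceLOneOf : (st : State) (i : ℕ) {e : LE} → SlotL st i e →
                  (m₁ : Maybe LE) (X₁ : List LE) (Y₁ : List RE) (m₂ : Maybe LE) (X₂ : List LE) (Y₂ : List RE) →
                  (Der (fromMaybe m₁ ++ X₁ ++ antecedent∖ st i) (Y₁ ++ succedent st) →
                   Der (fromMaybe m₂ ++ X₂ ++ antecedent∖ st i) (Y₂ ++ succedent st) →
                   Der (e ∷ antecedent∖ st i) (succedent st)) →
                  Σ State λ st′ → ReplacedL st st′ i m₁ X₁ Y₁ ⊎ ReplacedL st st′ i m₂ X₂ Y₂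
  replaceLOneOf st i s m₁ X₁ Y₁ m₂ X₂ Y₂ rule
    with underivablePremise rule (λ d → underivable st (permL (↭-sym (antecedent-↦ st i s)) d))
  ... | inj₁ ¬d₁ = let (st′ , r) = replaceLUnderivable st i s m₁ X₁ Y₁ ¬d₁ in st′ , inj₁ r
  ... | inj₂ ¬d₂ = let (st′ , r) = replaceLUnderivable st i s m₂ X₂ Y₂ ¬d₂ in st′ , inj₂ r

  replaceR : (st : State) (j : ℕ) {e : RE} → SlotR st j e → (m : Maybe RE) (X : List LE) (Y : List RE) →
             (Der (X ++ antecedent st) (fromMaybe m ++ Y ++ succedent∖ st j) → Der (antecedent st) (e ∷ succedent∖ st j)) →
             Σ State λ st′ → ReplacedR st st′ j m X Y
  replaceR st j s m X Y rule =
    replaceRUnderivable st j s m X Y (λ d → underivable st (permR (↭-sym (succedent-↦ st j s)) (rule d)))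

  replaceROneOf : (st : State) (j : ℕ) {e : RE} → SlotR st j e →
                  (m₁ : Maybe RE) (X₁ : List LE) (Y₁ : List RE) (m₂ : Maybe RE) (X₂ : List LE) (Y₂ : List RE) →
                  (Der (X₁ ++ antecedent st) (fromMaybe m₁ ++ Y₁ ++ succedent∖ st j) →
                   Der (X₂ ++ antecedent st) (fromMaybe m₂ ++ Y₂ ++ succedent∖ st j) →
                   Der (antecedent st) (e ∷ succedent∖ st j)) →
                  Σ State λ st′ → ReplacedR st st′ j m₁ X₁ Y₁ ⊎ ReplacedR st st′ j m₂ X₂ Y₂
  replaceROneOf st j s m₁ X₁ Y₁ m₂ X₂ Y₂ rule
    with underivablePremise rule (λ d → underivable st (permR (↭-sym (succedent-↦ st j s)) d))
  ... | inj₁ ¬d₁ = let (st′ , r) = replaceRUnderivable st j s m₁ X₁ Y₁ ¬d₁ in st′ , inj₁ r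
  ... | inj₂ ¬d₂ = let (st′ , r) = replaceRUnderivable st j s m₂ X₂ Y₂ ¬d₂ in st′ , inj₂ r
  data MatchL : Kind → LE → Set where
    mL∧ : ∀ w A B → MatchL kL∧ ⌜ w ∶ (A ∧′ B) ⌝
    mL∨ : ∀ w A B → MatchL kL∨ ⌜ w ∶ (A ∨′ B) ⌝
    mL⊃ : ∀ w A B → MatchL kL⊃ ⌜ w ∶ (A ⊃ B) ⌝
    mL∃ : ∀ w A → MatchL kL∃ ⌜ w ∶ ∃′ A ⌝
    mL◇ : ∀ w A → MatchL kL◇ ⌜ w ∶ ◇ A ⌝
    mLλ : ∀ w B t → MatchL kLλ ⌜ w ∶ lam B t ⌝
    mLD₁ : ∀ A x w → MatchL kLD₁ ⌜ D (iota A) x w ⌝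
    mLD₂ : ∀ A x w → MatchL kLD₂ ⌜ D (iota A) x w ⌝
    mDenId : ∀ y x w → MatchL kDenId ⌜ D (var (fv y)) x w ⌝

  matchL : (K : Kind) (e : LE) → Maybe (MatchL K e)
  matchL kL∧ ⌜ w ∶ (A ∧′ B) ⌝ = just (mL∧ w A B)
  matchL kL∨ ⌜ w ∶ (A ∨′ B) ⌝ = just (mL∨ w A B)
  matchL kL⊃ ⌜ w ∶ (A ⊃ B) ⌝ = just (mL⊃ w A B)
  matchL kL∃ ⌜ w ∶ ∃′ A ⌝ = just (mL∃ w A)
  matchL kL◇ ⌜ w ∶ ◇ A ⌝ = just (mL◇ w A)
  matchL kLλ ⌜ w ∶ lam B t ⌝ = just (mLλ w B t)
  matchL kLD₁ ⌜ D (iota A) x w ⌝ = just (mLD₁ A x w)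
  matchL kLD₂ ⌜ D (iota A) x w ⌝ = just (mLD₂ A x w)
  matchL kDenId ⌜ D (var (fv y)) x w ⌝ = just (mDenId y x w)
  matchL _ _ = nothing

  matchL-complete : ∀ {K e} (m : MatchL K e) → matchL K e ≡ just m
  matchL-complete (mL∧ w A B) = refl
  matchL-complete (mL∨ w A B) = refl
  matchL-complete (mL⊃ w A B) = refl
  matchL-complete (mL∃ w A) = refl
  matchL-complete (mL◇ w A) = refl
  matchL-complete (mLλ w B t) = refl
  matchL-complete (mLD₁ A x w) = refl
  matchL-complete (mLD₂ A x w) = refl
  matchL-complete (mDenId y x w) = refl

  MatchL-unique : ∀ {K e} (m m′ : MatchL K e) → m ≡ m′
  MatchL-unique (mL∧ w A B) (mL∧ .w .A .B) = refl
  MatchL-unique (mL∨ w A B) (mL∨ .w .A .B) = refl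
  MatchL-unique (mL⊃ w A B) (mL⊃ .w .A .B) = refl
  MatchL-unique (mL∃ w A) (mL∃ .w .A) = refl
  MatchL-unique (mL◇ w A) (mL◇ .w .A) = refl
  MatchL-unique (mLλ w B t) (mLλ .w .B .t) = refl
  MatchL-unique (mLD₁ A x w) (mLD₁ .A .x .w) = refl
  MatchL-unique (mLD₂ A x w) (mLD₂ .A .x .w) = refl
  MatchL-unique (mDenId y x w) (mDenId .y .x .w) = refl

  data MatchL₂ : Kind → LE → LE → Set where
    mL∀ : ∀ w A y → MatchL₂ kL∀ (y ∈ᵈ w) ⌜ w ∶ ∀′ A ⌝
    mL□ : ∀ w A v → MatchL₂ kL□ (w ℛ v) ⌜ w ∶ □ A ⌝
    mTrans : ∀ w v u → MatchL₂ kTrans (w ℛ v) (v ℛ u)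
    mEucl : ∀ w v u → MatchL₂ kEucl (w ℛ v) (w ℛ u)
    mIncr : ∀ x w v → MatchL₂ kIncr (x ∈ᵈ w) (w ℛ v)
    mDecr : ∀ x w v → MatchL₂ kDecr (x ∈ᵈ v) (w ℛ v)

  matchL₂ : (K : Kind) (a b : LE) → Maybe (MatchL₂ K a b)
  matchL₂ kL∀ (y ∈ᵈ w′) ⌜ w ∶ ∀′ A ⌝ with w′ ≟ w
  ... | yes refl = just (mL∀ w A y)
  ... | no _ = nothing
  matchL₂ kL□ (w′ ℛ v) ⌜ w ∶ □ A ⌝ with w′ ≟ w
  ... | yes refl = just (mL□ w A v)
  ... | no _ = nothing
  matchL₂ kTrans (w ℛ v) (v′ ℛ u) with v′ ≟ v
  ... | yes refl = just (mTrans w v u)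
  ... | no _ = nothing
  matchL₂ kEucl (w ℛ v) (w′ ℛ u) with w′ ≟ w
  ... | yes refl = just (mEucl w v u)
  ... | no _ = nothing
  matchL₂ kIncr (x ∈ᵈ w) (w′ ℛ v) with w′ ≟ w
  ... | yes refl = just (mIncr x w v)
  ... | no _ = nothing
  matchL₂ kDecr (x ∈ᵈ v) (w ℛ v′) with v′ ≟ v
  ... | yes refl = just (mDecr x w v)
  ... | no _ = nothing
  matchL₂ _ _ _ = nothing

  matchL₂-complete : ∀ {K a b} (m : MatchL₂ K a b) → matchL₂ K a b ≡ just m
  matchL₂-complete (mL∀ w A y) rewrite ≟-diag (refl {x = w}) = refl
  matchL₂-complete (mL□ w A v) rewrite ≟-diag (refl {x = w}) = refl
  matchL₂-complete (mTrans w v u) rewrite ≟-diag (refl {x = v}) = refl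
  matchL₂-complete (mEucl w v u) rewrite ≟-diag (refl {x = w}) = refl
  matchL₂-complete (mIncr x w v) rewrite ≟-diag (refl {x = w}) = refl
  matchL₂-complete (mDecr x w v) rewrite ≟-diag (refl {x = v}) = refl

  MatchL₂-unique : ∀ {K a b} (m m′ : MatchL₂ K a b) → m ≡ m′
  MatchL₂-unique (mL∀ w A y) (mL∀ .w .A .y) = refl
  MatchL₂-unique (mL□ w A v) (mL□ .w .A .v) = refl
  MatchL₂-unique (mTrans w v u) (mTrans .w .v .u) = refl
  MatchL₂-unique (mEucl w v u) (mEucl .w .v .u) = refl
  MatchL₂-unique (mIncr x w v) (mIncr .x .w .v) = refl
  MatchL₂-unique (mDecr x w v) (mDecr .x .w .v) = refl

  data MatchR : Kind → RE → Set where
    mR∧ : ∀ w A B → MatchR kR∧ (w ∶ (A ∧′ B))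
    mR∨ : ∀ w A B → MatchR kR∨ (w ∶ (A ∨′ B))
    mR⊃ : ∀ w A B → MatchR kR⊃ (w ∶ (A ⊃ B))
    mR∀ : ∀ w A → MatchR kR∀ (w ∶ ∀′ A)
    mR□ : ∀ w A → MatchR kR□ (w ∶ □ A)
    mRλ : ∀ w B t → MatchR kRλ (w ∶ lam B t)
    mRD : ∀ A x w → MatchR kRD (D (iota A) x w)

  matchR : (K : Kind) (e : RE) → Maybe (MatchR K e)
  matchR kR∧ (w ∶ (A ∧′ B)) = just (mR∧ w A B)
  matchR kR∨ (w ∶ (A ∨′ B)) = just (mR∨ w A B)
  matchR kR⊃ (w ∶ (A ⊃ B)) = just (mR⊃ w A B)
  matchR kR∀ (w ∶ ∀′ A) = just (mR∀ w A)
  matchR kR□ (w ∶ □ A) = just (mR□ w A)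
  matchR kRλ (w ∶ lam B t) = just (mRλ w B t)
  matchR kRD (D (iota A) x w) = just (mRD A x w)
  matchR _ _ = nothing

  matchR-complete : ∀ {K e} (m : MatchR K e) → matchR K e ≡ just m
  matchR-complete (mR∧ w A B) = refl
  matchR-complete (mR∨ w A B) = refl
  matchR-complete (mR⊃ w A B) = refl
  matchR-complete (mR∀ w A) = refl
  matchR-complete (mR□ w A) = refl
  matchR-complete (mRλ w B t) = refl
  matchR-complete (mRD A x w) = refl

  MatchR-unique : ∀ {K e} (m m′ : MatchR K e) → m ≡ m′
  MatchR-unique (mR∧ w A B) (mR∧ .w .A .B) = refl
  MatchR-unique (mR∨ w A B) (mR∨ .w .A .B) = refl
  MatchR-unique (mR⊃ w A B) (mR⊃ .w .A .B) = refl
  MatchR-unique (mR∀ w A) (mR∀ .w .A) = refl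
  MatchR-unique (mR□ w A) (mR□ .w .A) = refl
  MatchR-unique (mRλ w B t) (mRλ .w .B .t) = refl
  MatchR-unique (mRD A x w) (mRD .A .x .w) = refl

  data MatchRL : Kind → RE → LE → Set where
    mR∃ : ∀ w A y → MatchRL kR∃ (w ∶ ∃′ A) (y ∈ᵈ w)
    mR◇ : ∀ w A v → MatchRL kR◇ (w ∶ ◇ A) (w ℛ v)

  matchRL : (K : Kind) (a : RE) (b : LE) → Maybe (MatchRL K a b)
  matchRL kR∃ (w ∶ ∃′ A) (y ∈ᵈ w′) with w′ ≟ w
  ... | yes refl = just (mR∃ w A y)
  ... | no _ = nothing
  matchRL kR◇ (w ∶ ◇ A) (w′ ℛ v) with w′ ≟ w
  ... | yes refl = just (mR◇ w A v)
  ... | no _ = nothing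
  matchRL _ _ _ = nothing

  matchRL-complete : ∀ {K a b} (m : MatchRL K a b) → matchRL K a b ≡ just m
  matchRL-complete (mR∃ w A y) rewrite ≟-diag (refl {x = w}) = refl
  matchRL-complete (mR◇ w A v) rewrite ≟-diag (refl {x = w}) = refl

  MatchRL-unique : ∀ {K a b} (m m′ : MatchRL K a b) → m ≡ m′
  MatchRL-unique (mR∃ w A y) (mR∃ .w .A .y) = refl
  MatchRL-unique (mR◇ w A v) (mR◇ .w .A .v) = refl

  ReducedL : ∀ {K e} → MatchL K e → ℕ → State → Set
  ReducedL (mL∧ w A B) _ st = ⌜ w ∶ A ⌝ ∈L st × ⌜ w ∶ B ⌝ ∈L st
  ReducedL (mL∨ w A B) _ st = ⌜ w ∶ A ⌝ ∈L st ⊎ ⌜ w ∶ B ⌝ ∈L st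
  ReducedL (mL⊃ w A B) _ st = (w ∶ A) ∈R st ⊎ ⌜ w ∶ B ⌝ ∈L st
  ReducedL (mL∃ w A) _ st = ∃ λ z → (z ∈ᵈ w) ∈L st × ⌜ w ∶ A ⟪ z ⟫ ⌝ ∈L st
  ReducedL (mL◇ w A) _ st = ∃ λ u → (w ℛ u) ∈L st × ⌜ u ∶ A ⌝ ∈L st
  ReducedL (mLλ w B t) _ st = ∃ λ z → ⌜ D t z w ⌝ ∈L st × ⌜ w ∶ B ⟪ z ⟫ ⌝ ∈L st
  ReducedL (mLD₁ A x w) _ st = ⌜ w ∶ A ⟪ x ⟫ ⌝ ∈L st
  ReducedL (mLD₂ A x w) y st = (w ∶ A ⟪ y ⟫) ∈R st ⊎ ⌜ w ∶ (fv x ≐ fv y) ⌝ ∈L st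
  ReducedL (mDenId y x w) _ st = ⌜ w ∶ (fv y ≐ fv x) ⌝ ∈L st

  ReducedL₂ : ∀ {K a b} → MatchL₂ K a b → State → Set
  ReducedL₂ (mL∀ w A y) st = ⌜ w ∶ A ⟪ y ⟫ ⌝ ∈L st
  ReducedL₂ (mL□ w A v) st = ⌜ v ∶ A ⌝ ∈L st
  ReducedL₂ (mTrans w v u) st = T (N trans′) → (w ℛ u) ∈L st
  ReducedL₂ (mEucl w v u) st = T (N eucl) → (v ℛ u) ∈L st
  ReducedL₂ (mIncr x w v) st = T (N incr) → (x ∈ᵈ v) ∈L st
  ReducedL₂ (mDecr x w v) st = T (N decr) → (x ∈ᵈ w) ∈L st

  ReducedR : ∀ {K e} → MatchR K e → ℕ → State → Set
  ReducedR (mR∧ w A B) _ st = (w ∶ A) ∈R st ⊎ (w ∶ B) ∈R st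
  ReducedR (mR∨ w A B) _ st = (w ∶ A) ∈R st × (w ∶ B) ∈R st
  ReducedR (mR⊃ w A B) _ st = ⌜ w ∶ A ⌝ ∈L st × (w ∶ B) ∈R st
  ReducedR (mR∀ w A) _ st = ∃ λ z → (z ∈ᵈ w) ∈L st × (w ∶ A ⟪ z ⟫) ∈R st
  ReducedR (mR□ w A) _ st = ∃ λ u → (w ℛ u) ∈L st × (u ∶ A) ∈R st
  ReducedR (mRλ w B t) y st = D t y w ∈R st ⊎ (w ∶ B ⟪ y ⟫) ∈R st
  ReducedR (mRD A x w) _ st =
    (w ∶ A ⟪ x ⟫) ∈R st ⊎ (∃ λ z → ⌜ w ∶ A ⟪ z ⟫ ⌝ ∈L st × (w ∶ (fv x ≐ fv z)) ∈R st)

  ReducedRL : ∀ {K a b} → MatchRL K a b → State → Set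
  ReducedRL (mR∃ w A y) st = (w ∶ A ⟪ y ⟫) ∈R st
  ReducedRL (mR◇ w A v) st = (v ∶ A) ∈R st

  PostL PostL₂ PostR PostRL : Kind → ℕ → ℕ → State → State → Set
  PostL K i k st st′ = ∀ e → SlotL st i e → (m : MatchL K e) → ReducedL m k st′
  PostL₂ K i k st st′ = ∀ a b → SlotL st i a → SlotL st k b → (m : MatchL₂ K a b) → ReducedL₂ m st′
  PostR K j k st st′ = ∀ e → SlotR st j e → (m : MatchR K e) → ReducedR m k st′
  PostRL K j k st st′ = ∀ a b → SlotR st j a → SlotL st k b → (m : MatchRL K a b) → ReducedRL m st′

  Post : Task → State → State → Set
  Post (kL∧ , i , k) = PostL kL∧ i k
  Post (kL∨ , i , k) = PostL kL∨ i k
  Post (kL⊃ , i , k) = PostL kL⊃ i k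
  Post (kL∀ , i , k) = PostL₂ kL∀ i k
  Post (kL∃ , i , k) = PostL kL∃ i k
  Post (kL□ , i , k) = PostL₂ kL□ i k
  Post (kL◇ , i , k) = PostL kL◇ i k
  Post (kLλ , i , k) = PostL kLλ i k
  Post (kLD₁ , i , k) = PostL kLD₁ i k
  Post (kLD₂ , i , k) = PostL kLD₂ i k
  Post (kDenId , i , k) = PostL kDenId i k
  Post (kR∧ , i , k) = PostR kR∧ i k
  Post (kR∨ , i , k) = PostR kR∨ i k
  Post (kR⊃ , i , k) = PostR kR⊃ i k
  Post (kR∀ , i , k) = PostR kR∀ i k
  Post (kR∃ , i , k) = PostRL kR∃ i k
  Post (kR□ , i , k) = PostR kR□ i k
  Post (kR◇ , i , k) = PostRL kR◇ i k
  Post (kRλ , i , k) = PostR kRλ i k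
  Post (kRD , i , k) = PostR kRD i k
  Post (kRefW , i , k) = λ st st′ → T (N refW) → (i ℛ i) ∈L st′
  Post (kSer , i , k) = λ st st′ → T (N ser) → ∃ λ u → (i ℛ u) ∈L st′
  Post (kTrans , i , k) = PostL₂ kTrans i k
  Post (kEucl , i , k) = PostL₂ kEucl i k
  Post (kIncr , i , k) = PostL₂ kIncr i k
  Post (kDecr , i , k) = PostL₂ kDecr i k
  Post (kCons , i , k) = λ st st′ → T (N cons) → (i ∈ᵈ k) ∈L st′
  Post (kNoop , i , k) = λ st st′ → ⊤

  -- Slot k was emptied by task t: k is t's slot and t's rule consumes the expression.
  Consumes : Task → ℕ → Maybe Kind → Set
  Consumes t k c = just (proj₁ t) ≡ c × proj₁ (proj₂ t) ≡ k

  record Keeps (t : Task) (st st′ : State) : Set where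
    field
      keepsL : ∀ {k e} → SlotL st k e → SlotL st′ k e ⊎ Consumes t k (consumedByL e)
      keepsR : ∀ {k e} → SlotR st k e → SlotR st′ k e ⊎ Consumes t k (consumedByR e)

  keeps-refl : ∀ {t st} → Keeps t st st
  keeps-refl = record { keepsL = inj₁ ; keepsR = inj₁ }

  keeps-appended : ∀ {t st st′ X Y} → Appended st st′ X Y → Keeps t st st′
  keeps-appended a = record { keepsL = λ s → inj₁ (Appended.keepsL a s) ; keepsR = λ s → inj₁ (Appended.keepsR a s) }

  keeps-replacedL : ∀ {K i p st st′ m X Y e} → SlotL st i e → just K ≡ consumedByL e → ReplacedL st st′ i m X Y →
                    Keeps (K , i , p) st st′
  keeps-replacedL {K} {i} {p} {st} {st′} s consumed r =
    record { keepsL = keepsL′ ; keepsR = λ s′ → inj₁ (ReplacedL.keepsR r s′) }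
    where
    keepsL′ : ∀ {k e′} → SlotL st k e′ → SlotL st′ k e′ ⊎ Consumes (K , i , p) k (consumedByL e′)
    keepsL′ s′ with ReplacedL.keepsL r s′
    ... | inj₁ kept = inj₁ kept
    ... | inj₂ refl with ↦-unique (anteSlots st) i s s′
    ... | refl = inj₂ (consumed , refl)

  keeps-replacedR : ∀ {K j p st st′ m X Y e} → SlotR st j e → just K ≡ consumedByR e → ReplacedR st st′ j m X Y →
                    Keeps (K , j , p) st st′
  keeps-replacedR {K} {j} {p} {st} {st′} s consumed r =
    record { keepsL = λ s′ → inj₁ (ReplacedR.keepsL r s′) ; keepsR = keepsR′ }
    where
    keepsR′ : ∀ {k e′} → SlotR st k e′ → SlotR st′ k e′ ⊎ Consumes (K , j , p) k (consumedByR e′)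
    keepsR′ s′ with ReplacedR.keepsR r s′
    ... | inj₁ kept = inj₁ kept
    ... | inj₂ refl with ↦-unique (succSlots st) j s s′
    ... | refl = inj₂ (consumed , refl)

  StepResult : Task → State → (State → Set) → Set
  StepResult t st P = Σ State λ st′ → Keeps t st st′ × P st′

  mapResult : ∀ {t st} {P Q : State → Set} → (∀ {st′} → P st′ → Q st′) → StepResult t st P → StepResult t st Q
  mapResult f (st′ , keeps , p) = st′ , keeps , f p

  whenEnabled : ∀ {t st} {P : State → Set} r → (T (N r) → StepResult t st P) →
                StepResult t st (λ st′ → T (N r) → P st′)
  whenEnabled {st = st} r result with T? (N r)
  ... | yes on = mapResult (λ p _ → p) (result on)
  ... | no off = st , keeps-refl , λ on → ⊥-elim (off on)

  addL : ∀ {t} st x → (Der (x ∷ antecedent st) (succedent st) → Der (antecedent st) (succedent st)) →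
         StepResult t st (x ∈L_)
  addL st x rule = let (st′ , a) = append st (x ∷ []) [] rule in st′ , keeps-appended a , Appended.addedL a (here refl)

  addR : ∀ {t} st y → (Der (antecedent st) (y ∷ succedent st) → Der (antecedent st) (succedent st)) →
         StepResult t st (y ∈R_)
  addR st y rule = let (st′ , a) = append st [] (y ∷ []) rule in st′ , keeps-appended a , Appended.addedR a (here refl)

  keepingL₁ : ∀ st i {e x} → SlotL st i e → (∀ {Γ Δ} → Der (x ∷ e ∷ Γ) Δ → Der (e ∷ Γ) Δ) →
              Der (x ∷ antecedent st) (succedent st) → Der (antecedent st) (succedent st)
  keepingL₁ st i s rule d = permL (↭-sym (antecedent-↦ st i s)) (rule (permL (prep _ (antecedent-↦ st i s)) d))

  keepingL₂ : ∀ st i k {a b x} → SlotL st i a → SlotL st k b → k ≢ i →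
              (∀ {Γ Δ} → Der (x ∷ a ∷ b ∷ Γ) Δ → Der (a ∷ b ∷ Γ) Δ) →
              Der (x ∷ antecedent st) (succedent st) → Der (antecedent st) (succedent st)
  keepingL₂ st i k sa sb k≢i rule d =
    permL (↭-sym (antecedent-↦₂ st i k sa sb k≢i)) (rule (permL (prep _ (antecedent-↦₂ st i k sa sb k≢i)) d))

  keepingRL : ∀ st j k {a b y} → SlotR st j a → SlotL st k b →
              (∀ {Γ Δ} → Der (b ∷ Γ) (a ∷ y ∷ Δ) → Der (b ∷ Γ) (a ∷ Δ)) →
              Der (antecedent st) (y ∷ succedent st) → Der (antecedent st) (succedent st)
  keepingRL st j k sa sb rule d =
    perm (↭-sym (antecedent-↦ st k sb)) (↭-sym (succedent-↦ st j sa))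
      (rule (permR (swap _ _ ↭-refl) (perm (antecedent-↦ st k sb) (prep _ (succedent-↦ st j sa)) d)))

  distinctSlotsOr : ∀ st i k {a b} → SlotL st i a → SlotL st k b → k ≢ i ⊎ a ≡ b
  distinctSlotsOr st i k sa sb with k ≟ i
  ... | no k≢i = inj₁ k≢i
  ... | yes refl = inj₂ (↦-unique (anteSlots st) i sa sb)

  reduceL : ∀ {K e} (m : MatchL K e) (st : State) (i p : ℕ) → SlotL st i e → StepResult (K , i , p) st (ReducedL m p)
  reduceL (mL∧ w A B) st i p s with replaceL st i s (just ⌜ w ∶ A ⌝) (⌜ w ∶ B ⌝ ∷ []) [] L∧
  ... | st′ , r = st′ , keeps-replacedL s refl r , ReplacedL.newL r (here refl) , ReplacedL.addedL r (here refl)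
  reduceL (mL∨ w A B) st i p s with replaceLOneOf st i s (just ⌜ w ∶ A ⌝) [] [] (just ⌜ w ∶ B ⌝) [] [] L∨
  ... | st′ , inj₁ r = st′ , keeps-replacedL s refl r , inj₁ (ReplacedL.newL r (here refl))
  ... | st′ , inj₂ r = st′ , keeps-replacedL s refl r , inj₂ (ReplacedL.newL r (here refl))
  reduceL (mL⊃ w A B) st i p s with replaceLOneOf st i s nothing [] ((w ∶ A) ∷ []) (just ⌜ w ∶ B ⌝) [] [] L⊃
  ... | st′ , inj₁ r = st′ , keeps-replacedL s refl r , inj₁ (ReplacedL.addedR r (here refl))
  ... | st′ , inj₂ r = st′ , keeps-replacedL s refl r , inj₂ (ReplacedL.newL r (here refl))
  reduceL (mL∃ w A) st i p s
    with replaceL st i s (just (freshVar st ∈ᵈ w)) (⌜ w ∶ A ⟪ freshVar st ⟫ ⌝ ∷ []) []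
           (L∃ (freshVar-fresh st (⊆-antecedent-↦ st i s) (λ q → q)))
  ... | st′ , r = st′ , keeps-replacedL s refl r , freshVar st , ReplacedL.newL r (here refl) , ReplacedL.addedL r (here refl)
  reduceL (mL◇ w A) st i p s
    with replaceL st i s (just (w ℛ freshLabel st)) (⌜ freshLabel st ∶ A ⌝ ∷ []) []
           (L◇ (freshLabel-fresh st (⊆-antecedent-↦ st i s) (λ q → q)))
  ... | st′ , r = st′ , keeps-replacedL s refl r , freshLabel st , ReplacedL.newL r (here refl) , ReplacedL.addedL r (here refl)
  reduceL (mLλ w B t) st i p s
    with replaceL st i s (just ⌜ D t (freshVar st) w ⌝) (⌜ w ∶ B ⟪ freshVar st ⟫ ⌝ ∷ []) []
           (Lλ (freshVar-fresh st (⊆-antecedent-↦ st i s) (λ q → q)))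
  ... | st′ , r = st′ , keeps-replacedL s refl r , freshVar st , ReplacedL.newL r (here refl) , ReplacedL.addedL r (here refl)
  reduceL (mLD₁ A x w) st i p s = addL st _ (keepingL₁ st i s LD₁)
  reduceL (mLD₂ A x w) st i y s
    with appendOneOf st [] ((w ∶ A ⟪ y ⟫) ∷ []) (⌜ w ∶ (fv x ≐ fv y) ⌝ ∷ []) []
           (λ d₁ d₂ → permL (↭-sym (antecedent-↦ st i s))
                        (LD₂ (permL (antecedent-↦ st i s) d₁) (permL (prep _ (antecedent-↦ st i s)) d₂)))
  ... | st′ , inj₁ a = st′ , keeps-appended a , inj₁ (Appended.addedR a (here refl))
  ... | st′ , inj₂ a = st′ , keeps-appended a , inj₂ (Appended.addedL a (here refl))
  reduceL (mDenId y x w) st i p s = addL st _ (keepingL₁ st i s DenId)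

  reduceL₂ : ∀ {K a b} (m : MatchL₂ K a b) (st : State) (i k : ℕ) → SlotL st i a → SlotL st k b →
             StepResult (K , i , k) st (ReducedL₂ m)
  reduceL₂ (mL∀ w A y) st i k sa sb with distinctSlotsOr st i k sa sb
  ... | inj₁ k≢i = addL st _ (keepingL₂ st i k sa sb k≢i L∀)
  ... | inj₂ ()
  reduceL₂ (mL□ w A v) st i k sa sb with distinctSlotsOr st i k sa sb
  ... | inj₁ k≢i = addL st _ (keepingL₂ st i k sa sb k≢i L□)
  ... | inj₂ ()
  reduceL₂ (mTrans w v u) st i k sa sb = whenEnabled trans′ λ on → trans-step on (distinctSlotsOr st i k sa sb)
    where
    trans-step : T (N trans′) → k ≢ i ⊎ (w ℛ v) ≡ (v ℛ u) → StepResult (kTrans , i , k) st ((w ℛ u) ∈L_)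
    trans-step on (inj₁ k≢i) = addL st _ (keepingL₂ st i k sa sb k≢i (Trans on))
    trans-step on (inj₂ refl) = st , keeps-refl , i , sa
  reduceL₂ (mEucl w v u) st i k sa sb = whenEnabled eucl λ on → eucl-step on (distinctSlotsOr st i k sa sb)
    where
    eucl-step : T (N eucl) → k ≢ i ⊎ (w ℛ v) ≡ (w ℛ u) → StepResult (kEucl , i , k) st ((v ℛ u) ∈L_)
    eucl-step on (inj₁ k≢i) = addL st _ (keepingL₂ st i k sa sb k≢i (Eucl on))
    eucl-step on (inj₂ refl) = addL st _ (keepingL₁ st i sa (Euclᶜ on))
  reduceL₂ (mIncr x w v) st i k sa sb with distinctSlotsOr st i k sa sb
  ... | inj₁ k≢i = whenEnabled incr λ on → addL st _ (keepingL₂ st i k sa sb k≢i (Incr on))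
  ... | inj₂ ()
  reduceL₂ (mDecr x w v) st i k sa sb with distinctSlotsOr st i k sa sb
  ... | inj₁ k≢i = whenEnabled decr λ on → addL st _ (keepingL₂ st i k sa sb k≢i (Decr on))
  ... | inj₂ ()

  reduceR : ∀ {K e} (m : MatchR K e) (st : State) (j p : ℕ) → SlotR st j e → StepResult (K , j , p) st (ReducedR m p)
  reduceR (mR∧ w A B) st j p s with replaceROneOf st j s (just (w ∶ A)) [] [] (just (w ∶ B)) [] [] R∧
  ... | st′ , inj₁ r = st′ , keeps-replacedR s refl r , inj₁ (ReplacedR.newR r (here refl))
  ... | st′ , inj₂ r = st′ , keeps-replacedR s refl r , inj₂ (ReplacedR.newR r (here refl))
  reduceR (mR∨ w A B) st j p s with replaceR st j s (just (w ∶ A)) [] ((w ∶ B) ∷ []) R∨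
  ... | st′ , r = st′ , keeps-replacedR s refl r , ReplacedR.newR r (here refl) , ReplacedR.addedR r (here refl)
  reduceR (mR⊃ w A B) st j p s with replaceR st j s (just (w ∶ B)) (⌜ w ∶ A ⌝ ∷ []) [] R⊃
  ... | st′ , r = st′ , keeps-replacedR s refl r , ReplacedR.addedL r (here refl) , ReplacedR.newR r (here refl)
  reduceR (mR∀ w A) st j p s
    with replaceR st j s (just (w ∶ A ⟪ freshVar st ⟫)) ((freshVar st ∈ᵈ w) ∷ []) []
           (R∀ (freshVar-fresh st (λ q → q) (⊆-succedent-↦ st j s)))
  ... | st′ , r = st′ , keeps-replacedR s refl r , freshVar st , ReplacedR.addedL r (here refl) , ReplacedR.newR r (here refl)
  reduceR (mR□ w A) st j p s
    with replaceR st j s (just (freshLabel st ∶ A)) ((w ℛ freshLabel st) ∷ []) []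
           (R□ (freshLabel-fresh st (λ q → q) (⊆-succedent-↦ st j s)))
  ... | st′ , r = st′ , keeps-replacedR s refl r , freshLabel st , ReplacedR.addedL r (here refl) , ReplacedR.newR r (here refl)
  reduceR (mRλ w B t) st j y s
    with appendOneOf st [] (D t y w ∷ []) [] ((w ∶ B ⟪ y ⟫) ∷ [])
           (λ d₁ d₂ → permR (↭-sym (succedent-↦ st j s))
              (Rλ (permR (swap _ _ ↭-refl) (permR (prep _ (succedent-↦ st j s)) d₁))
                  (permR (swap _ _ ↭-refl) (permR (prep _ (succedent-↦ st j s)) d₂))))
  ... | st′ , inj₁ a = st′ , keeps-appended a , inj₁ (Appended.addedR a (here refl))
  ... | st′ , inj₂ a = st′ , keeps-appended a , inj₂ (Appended.addedR a (here refl))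
  reduceR (mRD A x w) st j p s
    with replaceROneOf st j s (just (w ∶ A ⟪ x ⟫)) [] []
           (just (w ∶ (fv x ≐ fv (freshVar st)))) (⌜ w ∶ A ⟪ freshVar st ⟫ ⌝ ∷ []) []
           (RD (freshVar-fresh st (λ q → q) (⊆-succedent-↦ st j s)))
  ... | st′ , inj₁ r = st′ , keeps-replacedR s refl r , inj₁ (ReplacedR.newR r (here refl))
  ... | st′ , inj₂ r =
    st′ , keeps-replacedR s refl r , inj₂ (freshVar st , ReplacedR.addedL r (here refl) , ReplacedR.newR r (here refl))

  reduceRL : ∀ {K a b} (m : MatchRL K a b) (st : State) (j k : ℕ) → SlotR st j a → SlotL st k b →
             StepResult (K , j , k) st (ReducedRL m)
  reduceRL (mR∃ w A y) st j k sa sb = addR st _ (keepingRL st j k sa sb R∃)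
  reduceRL (mR◇ w A v) st j k sa sb = addR st _ (keepingRL st j k sa sb R◇)

  private
    nothing≢just : ∀ {A : Set} {x : A} → nothing ≢ just x
    nothing≢just ()

  stepL : (K : Kind) (i p : ℕ) (st : State) → StepResult (K , i , p) st (PostL K i p st)
  stepL K i p st with at (anteSlots st) i in slot
  ... | nothing = st , keeps-refl , λ _ ()
  ... | just nothing = st , keeps-refl , λ _ ()
  ... | just (just e) with matchL K e in matched
  ...   | nothing = st , keeps-refl , λ { _ refl m → ⊥-elim (nothing≢just (trans (sym matched) (matchL-complete m))) }
  ...   | just m with reduceL m st i p slot
  ...     | st′ , keeps , reduced =
    st′ , keeps , λ { _ refl m′ → subst (λ m → ReducedL m p st′) (MatchL-unique m m′) reduced }

  stepL₂ : (K : Kind) (i k : ℕ) (st : State) → StepResult (K , i , k) st (PostL₂ K i k st)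
  stepL₂ K i k st with at (anteSlots st) i in slotᵢ | at (anteSlots st) k in slotₖ
  ... | nothing | _ = st , keeps-refl , λ _ _ ()
  ... | just nothing | _ = st , keeps-refl , λ _ _ ()
  ... | just (just a) | nothing = st , keeps-refl , λ _ _ _ ()
  ... | just (just a) | just nothing = st , keeps-refl , λ _ _ _ ()
  ... | just (just a) | just (just b) with matchL₂ K a b in matched
  ...   | nothing =
    st , keeps-refl , λ { _ _ refl refl m → ⊥-elim (nothing≢just (trans (sym matched) (matchL₂-complete m))) }
  ...   | just m with reduceL₂ m st i k slotᵢ slotₖ
  ...     | st′ , keeps , reduced =
    st′ , keeps , λ { _ _ refl refl m′ → subst (λ m → ReducedL₂ m st′) (MatchL₂-unique m m′) reduced }

  stepR : (K : Kind) (j p : ℕ) (st : State) → StepResult (K , j , p) st (PostR K j p st)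
  stepR K j p st with at (succSlots st) j in slot
  ... | nothing = st , keeps-refl , λ _ ()
  ... | just nothing = st , keeps-refl , λ _ ()
  ... | just (just e) with matchR K e in matched
  ...   | nothing = st , keeps-refl , λ { _ refl m → ⊥-elim (nothing≢just (trans (sym matched) (matchR-complete m))) }
  ...   | just m with reduceR m st j p slot
  ...     | st′ , keeps , reduced =
    st′ , keeps , λ { _ refl m′ → subst (λ m → ReducedR m p st′) (MatchR-unique m m′) reduced }

  stepRL : (K : Kind) (j k : ℕ) (st : State) → StepResult (K , j , k) st (PostRL K j k st)
  stepRL K j k st with at (succSlots st) j in slotⱼ | at (anteSlots st) k in slotₖ
  ... | nothing | _ = st , keeps-refl , λ _ _ ()
  ... | just nothing | _ = st , keeps-refl , λ _ _ ()
  ... | just (just a) | nothing = st , keeps-refl , λ _ _ _ ()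
  ... | just (just a) | just nothing = st , keeps-refl , λ _ _ _ ()
  ... | just (just a) | just (just b) with matchRL K a b in matched
  ...   | nothing =
    st , keeps-refl , λ { _ _ refl refl m → ⊥-elim (nothing≢just (trans (sym matched) (matchRL-complete m))) }
  ...   | just m with reduceRL m st j k slotⱼ slotₖ
  ...     | st′ , keeps , reduced =
    st′ , keeps , λ { _ _ refl refl m′ → subst (λ m → ReducedRL m st′) (MatchRL-unique m m′) reduced }

  step : (t : Task) (st : State) → StepResult t st (Post t st)
  step (kL∧ , i , k) st = stepL kL∧ i k st
  step (kL∨ , i , k) st = stepL kL∨ i k st
  step (kL⊃ , i , k) st = stepL kL⊃ i k st
  step (kL∀ , i , k) st = stepL₂ kL∀ i k st
  step (kL∃ , i , k) st = stepL kL∃ i k st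
  step (kL□ , i , k) st = stepL₂ kL□ i k st
  step (kL◇ , i , k) st = stepL kL◇ i k st
  step (kLλ , i , k) st = stepL kLλ i k st
  step (kLD₁ , i , k) st = stepL kLD₁ i k st
  step (kLD₂ , i , k) st = stepL kLD₂ i k st
  step (kDenId , i , k) st = stepL kDenId i k st
  step (kR∧ , i , k) st = stepR kR∧ i k st
  step (kR∨ , i , k) st = stepR kR∨ i k st
  step (kR⊃ , i , k) st = stepR kR⊃ i k st
  step (kR∀ , i , k) st = stepR kR∀ i k st
  step (kR∃ , i , k) st = stepRL kR∃ i k st
  step (kR□ , i , k) st = stepR kR□ i k st
  step (kR◇ , i , k) st = stepRL kR◇ i k st
  step (kRλ , i , k) st = stepR kRλ i k st
  step (kRD , i , k) st = stepR kRD i k st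
  step (kRefW , i , k) st = whenEnabled refW λ on → addL st _ (RefW on)
  step (kSer , i , k) st =
    whenEnabled ser λ on → mapResult (freshLabel st ,_) (addL st _ (Ser on (freshLabel-fresh st (λ q → q) (λ q → q))))
  step (kTrans , i , k) st = stepL₂ kTrans i k st
  step (kEucl , i , k) st = stepL₂ kEucl i k st
  step (kIncr , i , k) st = stepL₂ kIncr i k st
  step (kDecr , i , k) st = stepL₂ kDecr i k st
  step (kCons , i , k) st = whenEnabled cons λ on → addL st _ (Cons on)
  step (kNoop , i , k) st = st , keeps-refl , tt

module Closure (S : Sig) (N : RuleSet S) where

  open Syntax S using (substV-hit; substV-miss; substN-hit)
  open Slots using (∈⇒↭∷)
  open import Data.Nat using (suc; _≤_; _⊔_)
  open import Data.Nat.Properties using (≤-trans; m≤m⊔n; m≤n⊔m; n≮n; n<1+n; <⇒≢)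
  open import Data.Fin using (Fin; zero; suc)
  import Data.Fin as Fin
  open import Data.Vec using (Vec; []; _∷_; lookup; _[_]≔_)
  import Data.Vec as Vec
  open import Data.Vec.Properties using (lookup∘update; lookup∘update′; []≔-lookup)
  open import Data.List using ([]; _∷_; allFin)
  open import Data.List.Membership.Propositional using (_∈_; _∉_)
  open import Data.List.Membership.Propositional.Properties using (∈-allFin)
  open import Data.List.Relation.Unary.Any using (here; there)
  open import Data.List.Relation.Binary.Subset.Propositional using (_⊆_)
  open import Data.List.Relation.Binary.Subset.Propositional.Properties using (∷⁺ʳ)
  open import Data.List.Relation.Binary.Permutation.Propositional using (↭-refl; ↭-sym; ↭-trans; prep; swap)
  open import Data.List.Relation.Binary.Permutation.Propositional.Properties using (∈-resp-↭)
  open import Data.Product using (∃; _,_; proj₂)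
  open import Data.Empty using (⊥-elim)
  open import Relation.Binary.PropositionalEquality
  open import Relation.Nullary using (yes; no)
  open import Relation.Binary.Construct.Closure.Equivalence using (EqClosure)
  open import Relation.Binary.Construct.Closure.Symmetric using (fwd; bwd)
  open import Relation.Binary.Construct.Closure.ReflexiveTransitive using (ε; _◅_)

  LE : Set
  LE = LExpr S

  RE : Set
  RE = RExpr S

  -- Left weakening is built in, since the calculus has no weakening rule.
  Closed : List LE → List RE → Set
  Closed Γ Δ = ∀ Γ′ → Γ ⊆ Γ′ → _⊢_⇒_ S N Γ′ Δ

  Closed-mono : ∀ {Γ Γ′ Δ} → Closed Γ Δ → Γ ⊆ Γ′ → Closed Γ′ Δ
  Closed-mono c Γ⊆ Γ″ Γ′⊆ = c Γ″ (λ p → Γ′⊆ (Γ⊆ p))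

  eqAt : Label → VarName → VarName → LE
  eqAt w a b = ⌜ w ∶ (fv a ≐ fv b) ⌝

  closed-initAt : ∀ {Γ Δ w p} → Atomic S p → ⌜ w ∶ p ⌝ ∈ Γ → (w ∶ p) ∈ Δ → Closed Γ Δ
  closed-initAt at pΓ pΔ Γ′ Γ⊆ with ∈⇒↭∷ (Γ⊆ pΓ) | ∈⇒↭∷ pΔ
  ... | _ , Γ′↭ | _ , Δ↭ = perm (↭-sym Γ′↭) (↭-sym Δ↭) (initAt at)

  closed-initD : ∀ {Γ Δ y x w} → ⌜ D (var (fv y)) x w ⌝ ∈ Γ → D (var (fv y)) x w ∈ Δ → Closed Γ Δ
  closed-initD pΓ pΔ Γ′ Γ⊆ with ∈⇒↭∷ (Γ⊆ pΓ) | ∈⇒↭∷ pΔ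
  ... | _ , Γ′↭ | _ , Δ↭ = perm (↭-sym Γ′↭) (↭-sym Δ↭) initD

  closed-init⊥ : ∀ {Γ Δ w} → ⌜ w ∶ ⊥′ ⌝ ∈ Γ → Closed Γ Δ
  closed-init⊥ pΓ Γ′ Γ⊆ with ∈⇒↭∷ (Γ⊆ pΓ)
  ... | _ , Γ′↭ = perm (↭-sym Γ′↭) ↭-refl init⊥

  closed-Ref= : ∀ {Γ Δ} w x → Closed (eqAt w x x ∷ Γ) Δ → Closed Γ Δ
  closed-Ref= w x c Γ′ Γ⊆ = Ref= (c (_ ∷ Γ′) (∷⁺ʳ _ Γ⊆))

  closed-DenVar : ∀ {Γ Δ} x w → Closed (⌜ D (var (fv x)) x w ⌝ ∷ Γ) Δ → Closed Γ Δ
  closed-DenVar x w c Γ′ Γ⊆ = DenVar (c (_ ∷ Γ′) (∷⁺ʳ _ Γ⊆))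

  closed-RigVar : ∀ {Γ Δ v y z} w → eqAt v y z ∈ Γ → Closed (eqAt w y z ∷ Γ) Δ → Closed Γ Δ
  closed-RigVar w p c Γ′ Γ⊆ with ∈⇒↭∷ (Γ⊆ p)
  ... | Γ″ , Γ′↭ = perm (↭-sym Γ′↭) ↭-refl (RigVar (c _ Γ⊆′))
    where
    Γ⊆′ : eqAt w _ _ ∷ _ ⊆ eqAt w _ _ ∷ eqAt _ _ _ ∷ Γ″
    Γ⊆′ (here refl) = here refl
    Γ⊆′ (there q) = there (∈-resp-↭ Γ′↭ (Γ⊆ q))

  closed-Repl : ∀ {Γ Δ w y z x E} → ReplExpr S w E → eqAt w y z ∈ Γ → substL S y x E ∈ Γ →
                Closed (substL S z x E ∷ Γ) Δ → Closed Γ Δ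
  closed-Repl {Γ} {Δ} {w} {y} {z} {x} {E} re pEq pE c Γ′ Γ⊆ with ∈⇒↭∷ (Γ⊆ pEq) | ∈⇒↭∷ (Γ⊆ pE)
  ... | Γ₁ , Γ′↭₁ | Γ₂ , Γ′↭₂ =
    perm (↭-sym Γ′↭₁) ↭-refl (RigVar (perm (prep _ Γ′↭₁) ↭-refl
      (perm (↭-trans (swap _ _ ↭-refl) (prep _ (↭-sym Γ′↭₂))) ↭-refl (Repl re (c _ Γ⊆′)))))
    where
    Γ⊆′ : substL S z x E ∷ Γ ⊆ substL S z x E ∷ substL S y x E ∷ eqAt w y z ∷ Γ₂
    Γ⊆′ (here refl) = here refl
    Γ⊆′ (there q) with ∈-resp-↭ Γ′↭₂ (Γ⊆ q)
    ... | here r = there (here r)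
    ... | there r = there (there (there r))

  private
    ≢suc : ∀ x → x ≢ suc x
    ≢suc x = <⇒≢ (n<1+n x)

  -- Repl is used with a placeholder variable (here suc x) marking the position to be rewritten.
  closed-trans≐ : ∀ {Γ Δ w x y z} → eqAt w y z ∈ Γ → eqAt w x y ∈ Γ → Closed (eqAt w x z ∷ Γ) Δ → Closed Γ Δ
  closed-trans≐ {Γ} {Δ} {w} {x} {y} {z} pyz pxy c =
    closed-Repl {x = suc x} {E = ⌜ w ∶ (fv x ≐ fv (suc x)) ⌝} (rAtom _ (atEq _ _)) pyz
      (subst (_∈ Γ) (sym (at x y)) pxy) (subst (λ e → Closed (e ∷ Γ) Δ) (sym (at x z)) c)
    where
    at : ∀ x c → substL S c (suc x) ⌜ w ∶ (fv x ≐ fv (suc x)) ⌝ ≡ eqAt w x c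
    at x c = cong (λ e → ⌜ w ∶ e ⌝) (cong₂ _≐_ (substV-miss c (suc x) x (≢suc x)) (substV-hit c (suc x)))

  closed-sym≐ : ∀ {Γ Δ w y z} → eqAt w y z ∈ Γ → Closed (eqAt w z y ∷ Γ) Δ → Closed Γ Δ
  closed-sym≐ {Γ} {Δ} {w} {y} {z} pyz c =
    closed-Ref= w y (closed-Repl {Γ = eqAt w y y ∷ Γ} {x = suc y} {E = ⌜ w ∶ (fv (suc y) ≐ fv y) ⌝}
      (rAtom _ (atEq _ _)) (there pyz)
      (subst (_∈ eqAt w y y ∷ Γ) (sym (at y)) (here refl))
      (subst (λ e → Closed (e ∷ eqAt w y y ∷ Γ) Δ) (sym (at z)) (Closed-mono c Γ⊆)))
    where
    at : ∀ c → substL S c (suc y) ⌜ w ∶ (fv (suc y) ≐ fv y) ⌝ ≡ eqAt w c y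
    at c = cong (λ e → ⌜ w ∶ e ⌝) (cong₂ _≐_ (substV-hit c (suc y)) (substV-miss c (suc y) y (≢suc y)))
    Γ⊆ : eqAt w z y ∷ Γ ⊆ eqAt w z y ∷ eqAt w y y ∷ Γ
    Γ⊆ = ∷⁺ʳ _ (λ p → there p)

  module _ (R : VarName → VarName → Set) where

    Witnesses : List LE → Set
    Witnesses Γ = ∀ {a b} → R a b → ∃ λ v → eqAt v a b ∈ Γ

    Witnesses-mono : ∀ {Γ Γ′} → Witnesses Γ → Γ ⊆ Γ′ → Witnesses Γ′
    Witnesses-mono wit Γ⊆ r = let (v , p) = wit r in v , Γ⊆ p

    closed-addEq : ∀ {Γ Δ x y} → EqClosure R x y → Witnesses Γ → ∀ w → Closed (eqAt w x y ∷ Γ) Δ → Closed Γ Δ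
    closed-addEq ε wit w c = closed-Ref= w _ c
    closed-addEq (fwd r ◅ rest) wit w c =
      closed-RigVar w (proj₂ (wit r))
        (closed-addEq rest (Witnesses-mono wit there) w
          (closed-trans≐ (here refl) (there (here refl)) (Closed-mono c (∷⁺ʳ _ (λ p → there (there p))))))
    closed-addEq (bwd r ◅ rest) wit w c =
      closed-RigVar w (proj₂ (wit r)) (closed-sym≐ (here refl)
        (closed-addEq rest (Witnesses-mono wit (λ p → there (there p))) w
          (closed-trans≐ (here refl) (there (here refl)) (Closed-mono c (∷⁺ʳ _ (λ p → there (there (there p))))))))

    closed-≐R : ∀ {Γ Δ w x y} → EqClosure R x y → Witnesses Γ → (w ∶ (fv x ≐ fv y)) ∈ Δ → Closed Γ Δ
    closed-≐R chain wit p = closed-addEq chain wit _ (closed-initAt (atEq _ _) (here refl) p)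

    closed-DR : ∀ {Γ Δ w x y} → EqClosure R x y → Witnesses Γ → D (var (fv x)) y w ∈ Δ → Closed Γ Δ
    closed-DR {Γ} {Δ} {w} {x} {y} chain wit p =
      closed-addEq chain wit w (closed-DenVar x w
        (closed-Repl {Γ = Γ′} {x = suc x} {E = ⌜ D (var (fv x)) (suc x) w ⌝} (rDen x (suc x)) (there (here refl))
          (subst (_∈ Γ′) (sym (at x)) (here refl))
          (subst (λ e → Closed (e ∷ Γ′) Δ) (sym (at y)) (closed-initD (here refl) p))))
      where
      Γ′ = ⌜ D (var (fv x)) x w ⌝ ∷ eqAt w x y ∷ Γ
      at : ∀ c → substL S c (suc x) ⌜ D (var (fv x)) (suc x) w ⌝ ≡ ⌜ D (var (fv x)) c w ⌝
      at c = cong₂ (λ t v → ⌜ D t v w ⌝) (cong var (substV-miss c (suc x) x (≢suc x))) (substN-hit c (suc x))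

  name : Var 0 → VarName
  name (fv a) = a

  fv-name : (v : Var 0) → fv (name v) ≡ v
  fv-name (fv a) = refl

  maxName : ∀ {n} → Vec (Var 0) n → ℕ
  maxName [] = 0
  maxName (x ∷ v) = name x ⊔ maxName v

  lookup≤maxName : ∀ {n} (v : Vec (Var 0) n) j → name (lookup v j) ≤ maxName v
  lookup≤maxName (x ∷ v) zero = m≤m⊔n (name x) (maxName v)
  lookup≤maxName (x ∷ v) (suc j) = ≤-trans (lookup≤maxName v j) (m≤n⊔m (name x) (maxName v))

  lookup-ext : ∀ {A : Set} {n} (v u : Vec A n) → (∀ j → lookup v j ≡ lookup u j) → v ≡ u
  lookup-ext [] [] h = refl
  lookup-ext (x ∷ v) (y ∷ u) h = cong₂ _∷_ (h zero) (lookup-ext v u (λ j → h (suc j)))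

  map-substV-miss : ∀ {n} (v : Vec (Var 0) n) c q → (∀ j → name (lookup v j) ≢ q) → Vec.map (substV S c q) v ≡ v
  map-substV-miss [] c q fresh = refl
  map-substV-miss (fv a ∷ v) c q fresh =
    cong₂ _∷_ (substV-miss c q a (fresh zero)) (map-substV-miss v c q (λ j → fresh (suc j)))

  map-substV-update : ∀ {n} (v : Vec (Var 0) n) i c q → (∀ j → name (lookup v j) ≢ q) →
                      Vec.map (substV S c q) (v [ i ]≔ fv q) ≡ v [ i ]≔ fv c
  map-substV-update (x ∷ v) zero c q fresh = cong₂ _∷_ (substV-hit c q) (map-substV-miss v c q (λ j → fresh (suc j)))
  map-substV-update (fv a ∷ v) (suc i) c q fresh =
    cong₂ _∷_ (substV-miss c q a (fresh zero)) (map-substV-update v i c q (λ j → fresh (suc j)))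

  module _ (R : VarName → VarName → Set) where

    closed-replaceArg : ∀ {Γ Δ w P} (v : Vec (Var 0) (ar S P)) p {b} → EqClosure R (name (lookup v p)) b →
                        Witnesses R Γ → ⌜ w ∶ pred P v ⌝ ∈ Γ → Closed (⌜ w ∶ pred P (v [ p ]≔ fv b) ⌝ ∷ Γ) Δ →
                        Closed Γ Δ
    closed-replaceArg {Γ} {Δ} {w} {P} v p {b} chain wit mem c =
      closed-addEq R chain wit w
        (closed-Repl {Γ = Γ′} {x = q} {E = ⌜ w ∶ pred P (v [ p ]≔ fv q) ⌝} (rAtom _ (atP _ _)) (here refl)
          (subst (_∈ Γ′) (sym (trans (at a) (cong (λ u → ⌜ w ∶ pred P u ⌝) restore))) (there mem))
          (subst (λ e → Closed (e ∷ Γ′) Δ) (sym (at b)) (Closed-mono c (∷⁺ʳ _ there))))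
      where
      a = name (lookup v p)
      Γ′ = eqAt w a b ∷ Γ
      q = suc (maxName v)
      fresh : ∀ j → name (lookup v j) ≢ q
      fresh j eq = n≮n _ (subst (_≤ maxName v) eq (lookup≤maxName v j))
      at : ∀ c → substL S c q ⌜ w ∶ pred P (v [ p ]≔ fv q) ⌝ ≡ ⌜ w ∶ pred P (v [ p ]≔ fv c) ⌝
      at c = cong (λ u → ⌜ w ∶ pred P u ⌝) (map-substV-update v p c q fresh)
      restore : v [ p ]≔ fv a ≡ v
      restore = trans (cong (v [ p ]≔_) (fv-name (lookup v p))) ([]≔-lookup v p)

    -- The atom in Γ is rewritten one argument position at a time into the atom in Δ.
    closed-predR : ∀ {Γ Δ w P} (xs′ xs : Vec (Var 0) (ar S P)) →
                   (∀ j → EqClosure R (name (lookup xs′ j)) (name (lookup xs j))) →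
                   Witnesses R Γ → ⌜ w ∶ pred P xs′ ⌝ ∈ Γ → (w ∶ pred P xs) ∈ Δ → Closed Γ Δ
    closed-predR {Δ = Δ} {w} {P} xs′ xs chains wit mem pΔ =
      rewriteArgs (allFin _) xs′ chains (λ j j∉ → ⊥-elim (j∉ (∈-allFin j))) wit mem
      where
      rewriteArgs : ∀ {Γ} (ps : List (Fin (ar S P))) v → (∀ j → EqClosure R (name (lookup v j)) (name (lookup xs j))) →
                    (∀ j → j ∉ ps → lookup v j ≡ lookup xs j) → Witnesses R Γ → ⌜ w ∶ pred P v ⌝ ∈ Γ →
                    Closed Γ Δ
      rewriteArgs [] v _ done wit mem =
        closed-initAt (atP _ _) mem (subst (λ u → (w ∶ pred P u) ∈ Δ) (sym (lookup-ext v xs (λ j → done j λ ()))) pΔ)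
      rewriteArgs (p ∷ ps) v chains done wit mem =
        closed-replaceArg v p (chains p) wit mem
          (rewriteArgs ps v′ chains′ done′ (Witnesses-mono R wit there) (here refl))
        where
        v′ = v [ p ]≔ fv (name (lookup xs p))
        chains′ : ∀ j → EqClosure R (name (lookup v′ j)) (name (lookup xs j))
        chains′ j with j Fin.≟ p
        ... | yes refl = subst (λ u → EqClosure R (name u) (name (lookup xs p))) (sym (lookup∘update p v _)) ε
        ... | no j≢p = subst (λ u → EqClosure R (name u) (name (lookup xs j))) (sym (lookup∘update′ j≢p v _)) (chains j)
        done′ : ∀ j → j ∉ ps → lookup v′ j ≡ lookup xs j
        done′ j j∉ with j Fin.≟ p
        ... | yes refl = trans (lookup∘update p v _) (fv-name (lookup xs p))
        ... | no j≢p = trans (lookup∘update′ j≢p v _) (done j λ { (here j≡p) → j≢p j≡p ; (there q) → j∉ q })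

module FairSequence (lem : ∀ {ℓ : Level} → ExcludedMiddle ℓ) (S : Sig) (N : RuleSet S)
                    (Γ₀ : List (LExpr S)) (Δ₀ : List (RExpr S)) (¬d₀ : ¬ _⊢_⇒_ S N Γ₀ Δ₀) where

  open Slots
  open Enumeration
  open Reduction lem S N
  open import Data.Nat using (zero; suc; _+_; _∸_; _≤_; _⊔_; _≤′_; ≤′-refl; ≤′-step)
  open import Data.Nat.Properties using (≤-trans; m∸n+n≡m; m≤m⊔n; m≤n⊔m; m≤n+m; +-suc; ≤⇒≤′)
  open import Data.List using ([]; _∷_; map)
  open import Data.Maybe using (just; nothing; fromMaybe)
  open import Data.Product using (∃; _×_; _,_; proj₁; proj₂)
  open import Data.Sum using (inj₁; inj₂)
  open import Data.Empty using (⊥-elim)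
  open import Data.Bool using (T)
  open import Relation.Binary.PropositionalEquality

  initial : State
  initial = state (map just Γ₀) (map just Δ₀)
                  (λ d → ¬d₀ (subst₂ (_⊢_⇒_ S N) (catMaybes-map-just Γ₀) (catMaybes-map-just Δ₀) d))

  kinds : List Kind
  kinds = kL∧ ∷ kL∨ ∷ kL⊃ ∷ kL∀ ∷ kL∃ ∷ kL□ ∷ kL◇ ∷ kLλ ∷ kLD₁ ∷ kLD₂ ∷ kDenId ∷
          kR∧ ∷ kR∨ ∷ kR⊃ ∷ kR∀ ∷ kR∃ ∷ kR□ ∷ kR◇ ∷ kRλ ∷ kRD ∷
          kRefW ∷ kSer ∷ kTrans ∷ kEucl ∷ kIncr ∷ kDecr ∷ kCons ∷ []

  kindAt : ℕ → Kind
  kindAt c = fromMaybe kNoop (at kinds c)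

  kindAt-surjective : ∀ K → ∃ λ c → kindAt c ≡ K
  kindAt-surjective kL∧ = 0 , refl
  kindAt-surjective kL∨ = 1 , refl
  kindAt-surjective kL⊃ = 2 , refl
  kindAt-surjective kL∀ = 3 , refl
  kindAt-surjective kL∃ = 4 , refl
  kindAt-surjective kL□ = 5 , refl
  kindAt-surjective kL◇ = 6 , refl
  kindAt-surjective kLλ = 7 , refl
  kindAt-surjective kLD₁ = 8 , refl
  kindAt-surjective kLD₂ = 9 , refl
  kindAt-surjective kDenId = 10 , refl
  kindAt-surjective kR∧ = 11 , refl
  kindAt-surjective kR∨ = 12 , refl
  kindAt-surjective kR⊃ = 13 , refl
  kindAt-surjective kR∀ = 14 , refl
  kindAt-surjective kR∃ = 15 , refl
  kindAt-surjective kR□ = 16 , refl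
  kindAt-surjective kR◇ = 17 , refl
  kindAt-surjective kRλ = 18 , refl
  kindAt-surjective kRD = 19 , refl
  kindAt-surjective kRefW = 20 , refl
  kindAt-surjective kSer = 21 , refl
  kindAt-surjective kTrans = 22 , refl
  kindAt-surjective kEucl = 23 , refl
  kindAt-surjective kIncr = 24 , refl
  kindAt-surjective kDecr = 25 , refl
  kindAt-surjective kCons = 26 , refl
  kindAt-surjective kNoop = 27 , refl

  decode : ℕ → Task
  decode c = kindAt (proj₁ (unpair c)) , unpair (proj₂ (unpair c))

  -- Stage n performs the task coded by the first component of unpair n; each code recurs with
  -- every second component, hence infinitely often.
  task : ℕ → Task
  task n = decode (proj₁ (unpair n))

  task-fair : ∀ t m → ∃ λ n → m ≤ n × task n ≡ t
  task-fair (K , i , k) m with unpair-surjective i k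
  ... | r , er with kindAt-surjective K
  ... | a , ea with unpair-surjective a r
  ... | c , ec with unpair-surjective c m
  ... | n , en = n , m≤n , task≡
    where
    m≤n : m ≤ n
    m≤n = ≤-trans (m≤n+m m c) (subst (λ q → proj₁ q + proj₂ q ≤ n) en (unpair-sum≤ n))
    task≡ : task n ≡ (K , i , k)
    task≡ rewrite en | ec | er | ea = refl

  stage : ℕ → State
  stage zero = initial
  stage (suc n) = proj₁ (step (task n) (stage n))

  stage-keeps : ∀ n → Keeps (task n) (stage n) (stage (suc n))
  stage-keeps n = proj₁ (proj₂ (step (task n) (stage n)))

  stage-post : ∀ n {t} → task n ≡ t → Post t (stage n) (stage (suc n))
  stage-post n refl = proj₂ (proj₂ (step (task n) (stage n)))

  InΓω : LExpr S → Set
  InΓω e = ∃ λ n → e ∈L stage n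

  InΔω : RExpr S → Set
  InΔω e = ∃ λ n → e ∈R stage n

  persist : ∀ (P : ℕ → Set) → (∀ n → P n → P (suc n)) → ∀ {m n} → m ≤ n → P m → P n
  persist P step m≤n = go (≤⇒≤′ m≤n)
    where
    go : ∀ {m n} → m ≤′ n → P m → P n
    go ≤′-refl p = p
    go (≤′-step m≤′n) p = step _ (go m≤′n p)

  private
    just≢nothing : ∀ {A : Set} {a : A} → just a ≢ nothing
    just≢nothing ()

    just-injective : ∀ {A : Set} {a b : A} → just a ≡ just b → a ≡ b
    just-injective refl = refl

  persistentL : ∀ {e} → consumedByL e ≡ nothing → ∀ {m n k} → m ≤ n → SlotL (stage m) k e → SlotL (stage n) k e
  persistentL {e} never {k = k} = persist (λ n → SlotL (stage n) k e) kept
    where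
    kept : ∀ n → SlotL (stage n) k e → SlotL (stage (suc n)) k e
    kept n s with Keeps.keepsL (stage-keeps n) s
    ... | inj₁ s′ = s′
    ... | inj₂ (consumed , _) = ⊥-elim (just≢nothing (trans consumed never))

  persistentR : ∀ {e} → consumedByR e ≡ nothing → ∀ {m n k} → m ≤ n → SlotR (stage m) k e → SlotR (stage n) k e
  persistentR {e} never {k = k} = persist (λ n → SlotR (stage n) k e) kept
    where
    kept : ∀ n → SlotR (stage n) k e → SlotR (stage (suc n)) k e
    kept n s with Keeps.keepsR (stage-keeps n) s
    ... | inj₁ s′ = s′
    ... | inj₂ (consumed , _) = ⊥-elim (just≢nothing (trans consumed never))

  -- e cannot leave slot j before a task for its rule at slot j is performed.
  processedL : ∀ {e K} → consumedByL e ≡ just K → ∀ d {m j p} → SlotL (stage m) j e → task (d + m) ≡ (K , j , p) →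
               ∃ λ n → ∃ λ p′ → SlotL (stage n) j e × task n ≡ (K , j , p′)
  processedL consumed zero {m} {p = p} s t≡ = m , p , s , t≡
  processedL {K = K} consumed (suc d) {m} {j} {p} s t≡ with Keeps.keepsL (stage-keeps m) s
  ... | inj₂ (K≡ , j≡) =
    m , proj₂ (proj₂ (task m)) , s , cong₂ _,_ (just-injective (trans K≡ consumed)) (cong (_, proj₂ (proj₂ (task m))) j≡)
  ... | inj₁ s′ = processedL consumed d s′ (subst (λ q → task q ≡ (K , j , p)) (sym (+-suc d m)) t≡)

  processedR : ∀ {e K} → consumedByR e ≡ just K → ∀ d {m j p} → SlotR (stage m) j e → task (d + m) ≡ (K , j , p) →
               ∃ λ n → ∃ λ p′ → SlotR (stage n) j e × task n ≡ (K , j , p′)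
  processedR consumed zero {m} {p = p} s t≡ = m , p , s , t≡
  processedR {K = K} consumed (suc d) {m} {j} {p} s t≡ with Keeps.keepsR (stage-keeps m) s
  ... | inj₂ (K≡ , j≡) =
    m , proj₂ (proj₂ (task m)) , s , cong₂ _,_ (just-injective (trans K≡ consumed)) (cong (_, proj₂ (proj₂ (task m))) j≡)
  ... | inj₁ s′ = processedR consumed d s′ (subst (λ q → task q ≡ (K , j , p)) (sym (+-suc d m)) t≡)

  postL : ∀ {K e i p st st′} (mt : MatchL K e) → SlotL st i e → Post (K , i , p) st st′ → ReducedL mt p st′
  postL mt@(mL∧ _ _ _) s post = post _ s mt
  postL mt@(mL∨ _ _ _) s post = post _ s mt
  postL mt@(mL⊃ _ _ _) s post = post _ s mt
  postL mt@(mL∃ _ _) s post = post _ s mt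
  postL mt@(mL◇ _ _) s post = post _ s mt
  postL mt@(mLλ _ _ _) s post = post _ s mt
  postL mt@(mLD₁ _ _ _) s post = post _ s mt
  postL mt@(mLD₂ _ _ _) s post = post _ s mt
  postL mt@(mDenId _ _ _) s post = post _ s mt

  postL₂ : ∀ {K a b i k st st′} (mt : MatchL₂ K a b) → SlotL st i a → SlotL st k b → Post (K , i , k) st st′ →
           ReducedL₂ mt st′
  postL₂ mt@(mL∀ _ _ _) sa sb post = post _ _ sa sb mt
  postL₂ mt@(mL□ _ _ _) sa sb post = post _ _ sa sb mt
  postL₂ mt@(mTrans _ _ _) sa sb post = post _ _ sa sb mt
  postL₂ mt@(mEucl _ _ _) sa sb post = post _ _ sa sb mt
  postL₂ mt@(mIncr _ _ _) sa sb post = post _ _ sa sb mt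
  postL₂ mt@(mDecr _ _ _) sa sb post = post _ _ sa sb mt

  postR : ∀ {K e i p st st′} (mt : MatchR K e) → SlotR st i e → Post (K , i , p) st st′ → ReducedR mt p st′
  postR mt@(mR∧ _ _ _) s post = post _ s mt
  postR mt@(mR∨ _ _ _) s post = post _ s mt
  postR mt@(mR⊃ _ _ _) s post = post _ s mt
  postR mt@(mR∀ _ _) s post = post _ s mt
  postR mt@(mR□ _ _) s post = post _ s mt
  postR mt@(mRλ _ _ _) s post = post _ s mt
  postR mt@(mRD _ _ _) s post = post _ s mt

  postRL : ∀ {K a b i k st st′} (mt : MatchRL K a b) → SlotR st i a → SlotL st k b → Post (K , i , k) st st′ →
           ReducedRL mt st′
  postRL mt@(mR∃ _ _ _) sa sb post = post _ _ sa sb mt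
  postRL mt@(mR◇ _ _ _) sa sb post = post _ _ sa sb mt

  reducedConsumedL : ∀ {K e} (mt : MatchL K e) → consumedByL e ≡ just K → InΓω e →
                     ∃ λ n → ∃ λ p → ReducedL mt p (stage (suc n))
  reducedConsumedL {K} mt consumed (m , j , s) with task-fair (K , j , 0) m
  ... | n₀ , m≤n₀ , t≡
    with processedL consumed (n₀ ∸ m) s (subst (λ q → task q ≡ (K , j , 0)) (sym (m∸n+n≡m m≤n₀)) t≡)
  ... | n , p , s′ , t′≡ = n , p , postL mt s′ (stage-post n t′≡)

  reducedConsumedR : ∀ {K e} (mt : MatchR K e) → consumedByR e ≡ just K → InΔω e →
                     ∃ λ n → ∃ λ p → ReducedR mt p (stage (suc n))
  reducedConsumedR {K} mt consumed (m , j , s) with task-fair (K , j , 0) m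
  ... | n₀ , m≤n₀ , t≡
    with processedR consumed (n₀ ∸ m) s (subst (λ q → task q ≡ (K , j , 0)) (sym (m∸n+n≡m m≤n₀)) t≡)
  ... | n , p , s′ , t′≡ = n , p , postR mt s′ (stage-post n t′≡)

  reducedPersistentL : ∀ {K e} (mt : MatchL K e) → consumedByL e ≡ nothing → InΓω e →
                       ∀ p → ∃ λ n → ReducedL mt p (stage (suc n))
  reducedPersistentL {K} mt never (m , j , s) p with task-fair (K , j , p) m
  ... | n , m≤n , t≡ = n , postL mt (persistentL never m≤n s) (stage-post n t≡)

  reducedPersistentR : ∀ {K e} (mt : MatchR K e) → consumedByR e ≡ nothing → InΔω e →
                       ∀ p → ∃ λ n → ReducedR mt p (stage (suc n))
  reducedPersistentR {K} mt never (m , j , s) p with task-fair (K , j , p) m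
  ... | n , m≤n , t≡ = n , postR mt (persistentR never m≤n s) (stage-post n t≡)

  reducedL₂ : ∀ {K a b} (mt : MatchL₂ K a b) → consumedByL a ≡ nothing → consumedByL b ≡ nothing →
              InΓω a → InΓω b → ∃ λ n → ReducedL₂ mt (stage (suc n))
  reducedL₂ {K} mt never-a never-b (m₁ , i , sa) (m₂ , k , sb) with task-fair (K , i , k) (m₁ ⊔ m₂)
  ... | n , m≤n , t≡ =
    n , postL₂ mt (persistentL never-a (≤-trans (m≤m⊔n m₁ m₂) m≤n) sa)
                  (persistentL never-b (≤-trans (m≤n⊔m m₁ m₂) m≤n) sb) (stage-post n t≡)

  reducedRL : ∀ {K a b} (mt : MatchRL K a b) → consumedByR a ≡ nothing → consumedByL b ≡ nothing →
              InΔω a → InΓω b → ∃ λ n → ReducedRL mt (stage (suc n))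
  reducedRL {K} mt never-a never-b (m₁ , j , sa) (m₂ , k , sb) with task-fair (K , j , k) (m₁ ⊔ m₂)
  ... | n , m≤n , t≡ =
    n , postRL mt (persistentR never-a (≤-trans (m≤m⊔n m₁ m₂) m≤n) sa)
                  (persistentL never-b (≤-trans (m≤n⊔m m₁ m₂) m≤n) sb) (stage-post n t≡)

  reflexiveΓω : ∀ w → T (N refW) → InΓω (w ℛ w)
  reflexiveΓω w on = let (n , _ , t≡) = task-fair (kRefW , w , 0) 0 in suc n , post n t≡
    where
    post : ∀ n → task n ≡ (kRefW , w , 0) → (w ℛ w) ∈L stage (suc n)
    post n t≡ = stage-post n t≡ on

  serialΓω : ∀ w → T (N ser) → ∃ λ u → InΓω (w ℛ u)
  serialΓω w on = let (n , _ , t≡) = task-fair (kSer , w , 0) 0 ; (u , p) = post n t≡ in u , suc n , p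
    where
    post : ∀ n → task n ≡ (kSer , w , 0) → ∃ λ u → (w ℛ u) ∈L stage (suc n)
    post n t≡ = stage-post n t≡ on

  constantΓω : ∀ x w → T (N cons) → InΓω (x ∈ᵈ w)
  constantΓω x w on = let (n , _ , t≡) = task-fair (kCons , x , w) 0 in suc n , post n t≡
    where
    post : ∀ n → task n ≡ (kCons , x , w) → (x ∈ᵈ w) ∈L stage (suc n)
    post n t≡ = stage-post n t≡ on

module Countermodel (lem : ∀ {ℓ : Level} → ExcludedMiddle ℓ) (S : Sig) (N : RuleSet S)
                    (Γ₀ : List (LExpr S)) (Δ₀ : List (RExpr S)) (¬d₀ : ¬ _⊢_⇒_ S N Γ₀ Δ₀) where

  open Slots
  open Syntax S
  open Reduction lem S N
  open FairSequence lem S N Γ₀ Δ₀ ¬d₀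
  open import Defs using () renaming (trans to trans′)
  open Closure S N using (Closed; eqAt; closed-≐R; closed-DR; closed-predR; closed-init⊥; name)
  open import Data.Nat using (zero; suc; _+_; _≤_; _<_; _⊔_; s≤s; s<s⁻¹)
  open import Data.Nat.Properties using (≤-trans; ≤-refl; m≤m⊔n; m≤n⊔m; m≤m+n; m≤n+m; n<1+n; ≡-irrelevant; ≤-antisym)
  open import Data.Fin using (Fin; zero; suc)
  open import Data.Vec using (Vec; []; _∷_; lookup)
  import Data.Vec as Vec
  open import Data.Vec.Properties using (lookup-map)
  open import Data.List using ([]; _∷_; map)
  open import Data.List.Membership.Propositional using (_∈_; find)
  import Data.List.Relation.Unary.All as All
  open import Data.Maybe using (Maybe; just; nothing)
  open import Data.Product using (Σ; ∃; _×_; _,_; proj₁; proj₂)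
  open import Data.Sum using (inj₁; inj₂)
  open import Data.Empty using (⊥; ⊥-elim)
  open import Data.Unit using (⊤; tt)
  open import Data.Bool using (T)
  open import Function using (id; case_of_)
  open import Relation.Binary.PropositionalEquality
  open import Relation.Binary.Construct.Closure.Equivalence using (EqClosure; symmetric; transitive)
  open import Relation.Binary.Construct.Closure.Symmetric using (fwd; bwd)
  open import Relation.Binary.Construct.Closure.ReflexiveTransitive using (ε; _◅_)

  Eventually : (ℕ → Set) → Set
  Eventually P = ∃ λ n₀ → ∀ {n} → n₀ ≤ n → P n

  _⟨×⟩_ : ∀ {P Q : ℕ → Set} → Eventually P → Eventually Q → Eventually (λ n → P n × Q n)
  (n₁ , p) ⟨×⟩ (n₂ , q) = n₁ ⊔ n₂ , λ le → p (≤-trans (m≤m⊔n n₁ n₂) le) , q (≤-trans (m≤n⊔m n₁ n₂) le)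

  eventually-∀ : ∀ {m} (P : ℕ → Fin m → Set) → (∀ j → Eventually (λ n → P n j)) →
                 Eventually (λ n → ∀ j → P n j)
  eventually-∀ {zero} P h = 0 , λ _ ()
  eventually-∀ {suc m} P h with h zero ⟨×⟩ eventually-∀ (λ n j → P n (suc j)) (λ j → h (suc j))
  ... | n₀ , p = n₀ , λ { le zero → proj₁ (p le) ; le (suc j) → proj₂ (p le) j }

  stage-open : ∀ n → ¬ Closed (antecedent (stage n)) (succedent (stage n))
  stage-open n c = underivable (stage n) (c _ id)

  neverClosed : ∀ {P : ℕ → Set} → Eventually P → ¬ (∀ {n} → P n → Closed (antecedent (stage n)) (succedent (stage n)))
  neverClosed (n₀ , p) close = stage-open n₀ (close (p ≤-refl))

  eventuallyΓ : ∀ {e} → consumedByL e ≡ nothing → InΓω e → Eventually (λ n → e ∈ antecedent (stage n))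
  eventuallyΓ never (m , i , s) = m , λ {n} le → ∈-catMaybes⁺ (anteSlots (stage n)) i (persistentL never le s)

  eventuallyΔ : ∀ {e} → consumedByR e ≡ nothing → InΔω e → Eventually (λ n → e ∈ succedent (stage n))
  eventuallyΔ never (m , j , s) = m , λ {n} le → ∈-catMaybes⁺ (succSlots (stage n)) j (persistentR never le s)

  EqΓω : VarName → VarName → Set
  EqΓω a b = ∃ λ w → InΓω (eqAt w a b)

  EqAt : ℕ → VarName → VarName → Set
  EqAt n a b = ∃ λ w → eqAt w a b ∈ antecedent (stage n)

  infix 4 _~_
  _~_ : VarName → VarName → Set
  _~_ = EqClosure EqΓω

  ~-eventually : ∀ {a b} → a ~ b → Eventually (λ n → EqClosure (EqAt n) a b)
  ~-eventually ε = 0 , λ _ → ε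
  ~-eventually (fwd (w , eq) ◅ rest) with eventuallyΓ refl eq ⟨×⟩ ~-eventually rest
  ... | n₀ , p = n₀ , λ le → fwd (w , proj₁ (p le)) ◅ proj₂ (p le)
  ~-eventually (bwd (w , eq) ◅ rest) with eventuallyΓ refl eq ⟨×⟩ ~-eventually rest
  ... | n₀ , p = n₀ , λ le → bwd (w , proj₁ (p le)) ◅ proj₂ (p le)

  open Minimisation using (Least; least)

  repLeast : ∀ x → Least (_~ x)
  repLeast x = least (λ _ → lem) ε

  rep : VarName → VarName
  rep x = Least.value (repLeast x)

  rep-~ : ∀ x → rep x ~ x
  rep-~ x = Least.holds (repLeast x)

  rep-cong : ∀ {x y} → x ~ y → rep x ≡ rep y
  rep-cong {x} {y} x~y =
    ≤-antisym (Least.minimal (repLeast x) (transitive EqΓω (rep-~ y) (symmetric EqΓω x~y)))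
              (Least.minimal (repLeast y) (transitive EqΓω (rep-~ x) x~y))

  rep-idem : ∀ x → rep (rep x) ≡ rep x
  rep-idem x = rep-cong (rep-~ x)

  -- The quotient of names by ~, as the set of canonical representatives.
  Obj : Set
  Obj = Σ VarName λ y → rep y ≡ y

  σ : VarName → Obj
  σ x = rep x , rep-idem x

  Obj-≡ : ∀ {a b} {p : rep a ≡ a} {q : rep b ≡ b} → a ≡ b → _≡_ {A = Obj} (a , p) (b , q)
  Obj-≡ {p = p} {q} refl = cong (_ ,_) (≡-irrelevant p q)

  σ-proj₁ : (o : Obj) → σ (proj₁ o) ≡ o
  σ-proj₁ (y , p) = Obj-≡ p

  σ-sound : ∀ {x y} → x ~ y → σ x ≡ σ y
  σ-sound x~y = Obj-≡ (rep-cong x~y)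

  σ-complete : ∀ {x y} → σ x ≡ σ y → x ~ y
  σ-complete {x} {y} e =
    transitive EqΓω (symmetric EqΓω (rep-~ x)) (subst (_~ y) (sym (cong proj₁ e)) (rep-~ y))

  -- Labels are worlds; the extra world nothing is an isolated reflexive point whose domain is all of
  -- Obj, so that every object lies in some domain and every frame condition still holds.
  World : Set
  World = Maybe Label

  Rel : World → World → Set
  Rel (just w) (just v) = InΓω (w ℛ v)
  Rel nothing nothing = ⊤
  Rel (just _) nothing = ⊥
  Rel nothing (just _) = ⊥

  InDom : Obj → World → Set
  InDom o (just w) = ∃ λ x → InΓω (x ∈ᵈ w) × σ x ≡ o
  InDom o nothing = ⊤

  σ∘name : ∀ {n} → Vec (Var 0) n → Vec Obj n
  σ∘name = Vec.map (λ x → σ (name x))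

  Val : (P : Pred S) → World → Vec Obj (ar S P) → Set
  Val P (just w) os = ∃ λ xs → InΓω ⌜ w ∶ pred P xs ⌝ × σ∘name xs ≡ os
  Val P nothing os = ⊥

  model : Model S
  model = record { World = World ; Rel = Rel ; Obj = Obj ; InDom = InDom ; Val = Val
                 ; obj-in-some = λ o → nothing , tt ; nonempty = σ 0 }

  σ-≐Γω : ∀ {w a b} → InΓω (eqAt w a b) → σ a ≡ σ b
  σ-≐Γω {w} p = σ-sound (fwd (w , p) ◅ ε)

  σ-≐Δω : ∀ {w a b} → InΔω (w ∶ (fv a ≐ fv b)) → σ a ≢ σ b
  σ-≐Δω {w} {a} {b} p e =
    neverClosed (~-eventually (σ-complete e) ⟨×⟩ eventuallyΔ {w ∶ (fv a ≐ fv b)} refl p)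
      λ {n} (chain , pΔ) → closed-≐R (EqAt n) chain id pΔ

  σ-DΔω : ∀ {w a b} → InΔω (D (var (fv a)) b w) → σ a ≢ σ b
  σ-DΔω {w} {a} {b} p e =
    neverClosed (~-eventually (σ-complete e) ⟨×⟩ eventuallyΔ {D (var (fv a)) b w} refl p)
      λ {n} (chain , pΔ) → closed-DR (EqAt n) chain id pΔ

  Val-Δω : ∀ {w P xs} → InΔω (w ∶ pred P xs) → ¬ Val P (just w) (σ∘name xs)
  Val-Δω {w} {P} {xs} pΔ (xs′ , pΓ , e) =
    neverClosed (eventuallyΓ {⌜ w ∶ pred P xs′ ⌝} refl pΓ ⟨×⟩
                 (eventuallyΔ {w ∶ pred P xs} refl pΔ ⟨×⟩ eventually-∀ Chain chains))
      λ {n} (inΓ , inΔ , chains) → closed-predR (EqAt n) xs′ xs chains id inΓ inΔ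
    where
    Chain : ℕ → Fin (ar S P) → Set
    Chain n j = EqClosure (EqAt n) (name (lookup xs′ j)) (name (lookup xs j))
    chains : ∀ j → Eventually (λ n → Chain n j)
    chains j = ~-eventually (σ-complete (trans (sym (lookup-map j _ xs′)) (trans (cong (λ v → lookup v j) e) (lookup-map j _ xs))))

  open Semantics model using (Sat-⟨⟩)

  Sat₀ : World → Formula S 0 → Set
  Sat₀ w A = Sat S model σ [] w A

  SatO : World → Obj → Formula S 1 → Set
  SatO w o A = Sat S model σ (o ∷ []) w A

  Den₀ : World → Term S 0 → Obj → Set
  Den₀ w t o = Den S model σ [] w t o

  from⟨⟩ : ∀ {w} A y → Sat₀ w (A ⟪ y ⟫) → SatO w (σ y) A
  from⟨⟩ A y = proj₁ (Sat-⟨⟩ σ _ A y)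

  to⟨⟩ : ∀ {w} A y → SatO w (σ y) A → Sat₀ w (A ⟪ y ⟫)
  to⟨⟩ A y = proj₂ (Sat-⟨⟩ σ _ A y)

  SatO-σ : ∀ {w} A o → SatO w o A → SatO w (σ (proj₁ o)) A
  SatO-σ {w} A o = subst (λ o → SatO w o A) (sym (σ-proj₁ o))

  map-ev : ∀ {n} (xs : Vec (Var 0) n) → Vec.map (evV S model σ []) xs ≡ σ∘name xs
  map-ev [] = refl
  map-ev (fv a ∷ xs) = cong (σ a ∷_) (map-ev xs)

  <-+ˡ : ∀ {a b k} → suc (a + b) < suc k → a < k
  <-+ˡ {a} {b} lt = ≤-trans (s≤s (m≤m+n a b)) (s<s⁻¹ lt)

  <-+ʳ : ∀ {a b k} → suc (a + b) < suc k → b < k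
  <-+ʳ {a} {b} lt = ≤-trans (s≤s (m≤n+m b a)) (s<s⁻¹ lt)

  <-⟨⟩ : ∀ {k} (A : Formula S 1) y → suc (sizeF A) < suc k → sizeF (A ⟪ y ⟫) < k
  <-⟨⟩ A y lt = subst (_< _) (sym (sizeF-⟨⟩ A y)) (s<s⁻¹ lt)

  <-⟨⟩+ˡ : ∀ {k b} (A : Formula S 1) y → suc (sizeF A + b) < suc k → sizeF (A ⟪ y ⟫) < k
  <-⟨⟩+ˡ A y lt = subst (_< _) (sym (sizeF-⟨⟩ A y)) (<-+ˡ lt)

  -- Recursion on a bound k for the size, as A ⟪ y ⟫ is not a structural subterm of ∀′ A.
  mutual
    truthΓ : ∀ k w (A : Formula S 0) → sizeF A < k → InΓω ⌜ w ∶ A ⌝ → Sat₀ (just w) A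
    truthΓ (suc k) w (pred P xs) lt p = xs , p , sym (map-ev xs)
    truthΓ (suc k) w (fv a ≐ fv b) lt p = σ-≐Γω p
    truthΓ (suc k) w ⊥′ lt (m , i , s) = ⊥-elim (stage-open m (closed-init⊥ (∈-catMaybes⁺ (anteSlots (stage m)) i s)))
    truthΓ (suc k) w (A ∧′ B) lt p =
      let (n , _ , pA , pB) = reducedConsumedL (mL∧ w A B) refl p
      in truthΓ k w A (<-+ˡ lt) (suc n , pA) , truthΓ k w B (<-+ʳ lt) (suc n , pB)
    truthΓ (suc k) w (A ∨′ B) lt p = case reducedConsumedL (mL∨ w A B) refl p of λ
      { (n , _ , inj₁ pA) → inj₁ (truthΓ k w A (<-+ˡ lt) (suc n , pA))
      ; (n , _ , inj₂ pB) → inj₂ (truthΓ k w B (<-+ʳ lt) (suc n , pB)) }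
    truthΓ (suc k) w (A ⊃ B) lt p = case reducedConsumedL (mL⊃ w A B) refl p of λ
      { (n , _ , inj₁ pA) → λ sA → ⊥-elim (truthΔ k w A (<-+ˡ lt) (suc n , pA) sA)
      ; (n , _ , inj₂ pB) → λ _ → truthΓ k w B (<-+ʳ lt) (suc n , pB) }
    truthΓ (suc k) w (∀′ A) lt p o (y , py , refl) =
      let (n , pA) = reducedL₂ (mL∀ w A y) refl refl py p
      in from⟨⟩ A y (truthΓ k w (A ⟪ y ⟫) (<-⟨⟩ A y lt) (suc n , pA))
    truthΓ (suc k) w (∃′ A) lt p =
      let (n , _ , z , pz , pA) = reducedConsumedL (mL∃ w A) refl p
      in σ z , (z , (suc n , pz) , refl) , from⟨⟩ A z (truthΓ k w (A ⟪ z ⟫) (<-⟨⟩ A z lt) (suc n , pA))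
    truthΓ (suc k) w (□ A) lt p (just v) r =
      let (n , pA) = reducedL₂ (mL□ w A v) refl refl r p in truthΓ k v A (s<s⁻¹ lt) (suc n , pA)
    truthΓ (suc k) w (◇ A) lt p =
      let (n , _ , u , pu , pA) = reducedConsumedL (mL◇ w A) refl p
      in just u , (suc n , pu) , truthΓ k u A (s<s⁻¹ lt) (suc n , pA)
    truthΓ (suc k) w (lam B t) lt p =
      let (n , _ , z , pD , pB) = reducedConsumedL (mLλ w B t) refl p
      in σ z , truthDΓ k w t z (<-+ʳ lt) (suc n , pD) , from⟨⟩ B z (truthΓ k w (B ⟪ z ⟫) (<-⟨⟩+ˡ B z lt) (suc n , pB))

    truthΔ : ∀ k w (A : Formula S 0) → sizeF A < k → InΔω (w ∶ A) → ¬ Sat₀ (just w) A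
    truthΔ (suc k) w (pred P xs) lt p s = Val-Δω p (subst (Val P (just w)) (map-ev xs) s)
    truthΔ (suc k) w (fv a ≐ fv b) lt p s = σ-≐Δω p s
    truthΔ (suc k) w (A ∧′ B) lt p (sA , sB) = case reducedConsumedR (mR∧ w A B) refl p of λ
      { (n , _ , inj₁ pA) → truthΔ k w A (<-+ˡ lt) (suc n , pA) sA
      ; (n , _ , inj₂ pB) → truthΔ k w B (<-+ʳ lt) (suc n , pB) sB }
    truthΔ (suc k) w (A ∨′ B) lt p s =
      let (n , _ , pA , pB) = reducedConsumedR (mR∨ w A B) refl p
      in case s of λ
        { (inj₁ sA) → truthΔ k w A (<-+ˡ lt) (suc n , pA) sA
        ; (inj₂ sB) → truthΔ k w B (<-+ʳ lt) (suc n , pB) sB }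
    truthΔ (suc k) w (A ⊃ B) lt p f =
      let (n , _ , pA , pB) = reducedConsumedR (mR⊃ w A B) refl p
      in truthΔ k w B (<-+ʳ lt) (suc n , pB) (f (truthΓ k w A (<-+ˡ lt) (suc n , pA)))
    truthΔ (suc k) w (∀′ A) lt p f =
      let (n , _ , z , pz , pA) = reducedConsumedR (mR∀ w A) refl p
      in truthΔ k w (A ⟪ z ⟫) (<-⟨⟩ A z lt) (suc n , pA) (to⟨⟩ A z (f (σ z) (z , (suc n , pz) , refl)))
    truthΔ (suc k) w (∃′ A) lt p (o , (y , py , refl) , s) =
      let (n , pA) = reducedRL (mR∃ w A y) refl refl p py
      in truthΔ k w (A ⟪ y ⟫) (<-⟨⟩ A y lt) (suc n , pA) (to⟨⟩ A y s)
    truthΔ (suc k) w (□ A) lt p f =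
      let (n , _ , u , pu , pA) = reducedConsumedR (mR□ w A) refl p
      in truthΔ k u A (s<s⁻¹ lt) (suc n , pA) (f (just u) (suc n , pu))
    truthΔ (suc k) w (◇ A) lt p (just v , r , s) =
      let (n , pA) = reducedRL (mR◇ w A v) refl refl p r in truthΔ k v A (s<s⁻¹ lt) (suc n , pA) s
    truthΔ (suc k) w (lam B t) lt p (o , den , s) = case reducedPersistentR (mRλ w B t) refl p (proj₁ o) of λ
      { (n , inj₁ pD) → truthDΔ k w t (proj₁ o) (<-+ʳ lt) (suc n , pD) (subst (Den₀ (just w) t) (sym (σ-proj₁ o)) den)
      ; (n , inj₂ pB) → truthΔ k w (B ⟪ proj₁ o ⟫) (<-⟨⟩+ˡ B _ lt) (suc n , pB) (to⟨⟩ B _ (SatO-σ B o s)) }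

    truthDΓ : ∀ k w (t : Term S 0) z → sizeT t < k → InΓω ⌜ D t z w ⌝ → Den₀ (just w) t (σ z)
    truthDΓ (suc k) w (var (fv y)) z lt p =
      let (n , pEq) = reducedPersistentL (mDenId y z w) refl p 0 in σ-≐Γω (suc n , pEq)
    truthDΓ (suc k) w (iota C) z lt p =
      (let (n , pC) = reducedPersistentL (mLD₁ C z w) refl p 0
       in from⟨⟩ C z (truthΓ k w (C ⟪ z ⟫) (<-⟨⟩ C z lt) (suc n , pC))) ,
      λ o s → case reducedPersistentL (mLD₂ C z w) refl p (proj₁ o) of λ
        { (n , inj₁ pC) → ⊥-elim (truthΔ k w (C ⟪ proj₁ o ⟫) (<-⟨⟩ C _ lt) (suc n , pC) (to⟨⟩ C _ (SatO-σ C o s)))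
        ; (n , inj₂ pEq) → trans (sym (σ-proj₁ o)) (sym (σ-≐Γω (suc n , pEq))) }

    truthDΔ : ∀ k w (t : Term S 0) z → sizeT t < k → InΔω (D t z w) → ¬ Den₀ (just w) t (σ z)
    truthDΔ (suc k) w (var (fv y)) z lt p den = σ-DΔω p den
    truthDΔ (suc k) w (iota C) z lt p (s , uniq) = case reducedConsumedR (mRD C z w) refl p of λ
      { (n , _ , inj₁ pC) → truthΔ k w (C ⟪ z ⟫) (<-⟨⟩ C z lt) (suc n , pC) (to⟨⟩ C z s)
      ; (n , _ , inj₂ (z′ , pC , pEq)) →
          σ-≐Δω (suc n , pEq)
            (sym (uniq (σ z′) (from⟨⟩ C z′ (truthΓ k w (C ⟪ z′ ⟫) (<-⟨⟩ C z′ lt) (suc n , pC))))) }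

  satL : ∀ e → InΓω e → SatL S model just σ e
  satL ⌜ w ∶ A ⌝ p = truthΓ _ w A (n<1+n _) p
  satL ⌜ D (var (fv y)) x w ⌝ p = truthDΓ _ w (var (fv y)) x (n<1+n _) p
  satL ⌜ D (iota A) y w ⌝ p = λ o → unique o , λ { refl → satisfied }
    where
    open Σ (truthDΓ _ w (iota A) y (n<1+n _) p) renaming (proj₁ to satisfied; proj₂ to unique)
  satL (x ∈ᵈ w) p = x , p , refl
  satL (w ℛ v) p = p

  ¬satR : ∀ e → InΔω e → ¬ SatR S model just σ e
  ¬satR (w ∶ A) p = truthΔ _ w A (n<1+n _) p
  ¬satR (D (var (fv y)) x w) p = truthDΔ _ w (var (fv y)) x (n<1+n _) p
  ¬satR (D (iota A) y w) p h = truthDΔ _ w (iota A) y (n<1+n _) p (proj₂ (h (σ y)) refl , λ o s → proj₁ (h o) s)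

  reflexive : T (N refW) → FrameCond S model refW
  reflexive on nothing = tt
  reflexive on (just w) = reflexiveΓω w on

  serial : T (N ser) → FrameCond S model ser
  serial on nothing = nothing , tt
  serial on (just w) = let (u , p) = serialΓω w on in just u , p

  transitive′ : T (N trans′) → FrameCond S model trans′
  transitive′ on (just w) (just v) (just u) r₁ r₂ = let (n , p) = reducedL₂ (mTrans w v u) refl refl r₁ r₂ in suc n , p on
  transitive′ on nothing nothing nothing _ _ = tt
  transitive′ on nothing (just _) _ () _
  transitive′ on (just _) nothing _ () _
  transitive′ on nothing nothing (just _) _ ()
  transitive′ on (just _) (just _) nothing _ ()

  euclidean : T (N eucl) → FrameCond S model eucl
  euclidean on (just w) (just v) (just u) r₁ r₂ = let (n , p) = reducedL₂ (mEucl w v u) refl refl r₁ r₂ in suc n , p on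
  euclidean on nothing nothing nothing _ _ = tt
  euclidean on nothing (just _) _ () _
  euclidean on (just _) nothing _ () _
  euclidean on nothing nothing (just _) _ ()
  euclidean on (just _) (just _) nothing _ ()

  increasing : T (N incr) → FrameCond S model incr
  increasing on (just w) (just v) o r (x , px , refl) =
    let (n , p) = reducedL₂ (mIncr x w v) refl refl px r in x , (suc n , p on) , refl
  increasing on nothing nothing o _ _ = tt
  increasing on nothing (just _) o () _
  increasing on (just _) nothing o () _

  decreasing : T (N decr) → FrameCond S model decr
  decreasing on (just w) (just v) o r (x , px , refl) =
    let (n , p) = reducedL₂ (mDecr x w v) refl refl px r in x , (suc n , p on) , refl
  decreasing on nothing nothing o _ _ = tt
  decreasing on nothing (just _) o () _
  decreasing on (just _) nothing o () _

  constant : T (N cons) → FrameCond S model cons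
  constant on nothing o = tt
  constant on (just w) o = proj₁ o , constantΓω (proj₁ o) w on , σ-proj₁ o

  isModel : IsModelFor S N model
  isModel refW = reflexive
  isModel ser = serial
  isModel trans′ = transitive′
  isModel eucl = euclidean
  isModel incr = increasing
  isModel decr = decreasing
  isModel cons = constant

  initialΓω : ∀ {e} → e ∈ Γ₀ → InΓω e
  initialΓω {e} p = 0 , ∈-catMaybes⁻ (map just Γ₀) (subst (e ∈_) (sym (catMaybes-map-just Γ₀)) p)

  initialΔω : ∀ {e} → e ∈ Δ₀ → InΔω e
  initialΔω {e} p = 0 , ∈-catMaybes⁻ (map just Δ₀) (subst (e ∈_) (sym (catMaybes-map-just Δ₀)) p)

  invalid : ¬ Valid S N Γ₀ Δ₀
  invalid valid with find (valid model isModel just σ (All.tabulate λ p → satL _ (initialΓω p)))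
  ... | e , e∈ , s = ¬satR e (initialΔω e∈) s

mainTheorem2 : (∀ {ℓ : Level} → ExcludedMiddle ℓ) →
    (S : Sig) (N : RuleSet S) (Γ : List (LExpr S)) (Δ : List (RExpr S)) →
    Valid S N Γ Δ → _⊢_⇒_ S N Γ Δ
mainTheorem2 lem S N Γ Δ valid with lem {P = _⊢_⇒_ S N Γ Δ}
... | yes derivable = derivable
... | no underivable = ⊥-elim (Countermodel.invalid lem S N Γ Δ underivable valid)
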